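{- There is an absolute constant $c>0$ such that for all sufficiently large $n$ and all integers $k$ with $|k-n/2|\le\sqrt n$, $$\mathrm{mis}(\mathcal B_{n,k})\ge c\, n^{3/2}2^{\binom{n-1}{k}}.$$
   Context: $\mathcal B_{n,k}$ is the bipartite graph with vertex set $\binom{[n]}{k}\cup\binom{[n]}{k+1}$ (all $k$-subsets and $(k+1)$-subsets of $[n]$), where two sets are adjacent iff one is contained in the other. For a graph $G$, $\mathrm{mis}(G)$ is the number of maximal independent sets of $G$ (independent sets $I$ such that $I\cup\{v\}$ is not independent for every vertex $v\notin I$). -}

module Defs where

open import Data.Bool using (Bool; true; false; _∧_; _∨_; not)
open import Data.Nat using (ℕ; zero; suc; _≡ᵇ_)
open import Data.List using (List; []; _∷_; [_]; map; _++_; filterᵇ; length)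
open import Data.Bool.ListAction using (all; any)
open import Data.Vec using (_∷_; [])
open import Data.Fin.Subset using (Subset; inside; outside; ∣_∣)
open import Data.Fin.Subset.Properties using (_⊆?_)
open import Relation.Nullary.Decidable using (⌊_⌋)

allSubsets : (n : ℕ) → List (Subset n)
allSubsets zero = [ [] ]
allSubsets (suc n) = map (inside ∷_) (allSubsets n) ++ map (outside ∷_) (allSubsets n)

-- All sublists of a list (each choice of positions exactly once);
-- for a duplicate-free list these are exactly its subsets.
sublists : {A : Set} → List A → List (List A)
sublists [] = [ [] ]
sublists (x ∷ xs) = map (x ∷_) (sublists xs) ++ sublists xs

-- A finite simple graph given by a duplicate-free vertex list and a
-- (Boolean, symmetric, irreflexive) adjacency test.
record FinGraph : Set₁ where
  field
    Vtx   : Set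
    verts : List Vtx
    _==_  : Vtx → Vtx → Bool
    adj   : Vtx → Vtx → Bool

module _ (G : FinGraph) where
  open FinGraph G

  isIndependent : List Vtx → Bool
  isIndependent I = all (λ u → all (λ v → not (adj u v)) I) I

  isMaximal : List Vtx → Bool
  isMaximal I = all (λ v → any (v ==_) I ∨ any (adj v) I) verts

  isMIS : List Vtx → Bool
  isMIS I = isIndependent I ∧ isMaximal I

  mis : ℕ
  mis = length (filterᵇ isMIS (sublists verts))

-- The graph B_{n,k}: vertices are the k- and (k+1)-subsets of [n];
-- two sets are adjacent iff they have different sizes and one is
-- contained in the other (equivalently: one is properly contained in
-- the other, as sets on different levels are distinct).
levelVerts : (n k : ℕ) → List (Subset n)
levelVerts n k = filterᵇ (λ s → (∣ s ∣ ≡ᵇ k) ∨ (∣ s ∣ ≡ᵇ suc k)) (allSubsets n)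

B : (n k : ℕ) → FinGraph
B n k = record
  { Vtx   = Subset n
  ; verts = levelVerts n k
  ; _==_  = λ s t → ⌊ s ⊆? t ⌋ ∧ ⌊ t ⊆? s ⌋
  ; adj   = λ s t → not (∣ s ∣ ≡ᵇ ∣ t ∣) ∧ (⌊ s ⊆? t ⌋ ∨ ⌊ t ⊆? s ⌋)
  }

-- Split [n] as {0} ∪ [m] and view a vertex of B n k as a set s ⊆ [m],
-- possibly together with 0.  Fix a (k+1)-set U ⊆ [m], a (k-1)-set T ⊆ U and
-- a family 𝒜 of k-sets S ⊆ [m] with T ⊈ S ⊈ U.  Every k-set S ⊆ [m] except the
-- two sets between T and U is put into I either as S (when T ⊆ S, or when
-- S ∈ 𝒜 and S ⊈ U) or as S ∪ {0}; every other vertex joins I exactly when it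
-- has no neighbour among these.  I is a maximal independent set, and it
-- determines (T, U, 𝒜): the k-sets that enter I in neither form are the two
-- sets between T and U.  At most m + 2 of the k-sets are comparable with T or
-- U, so
--   mis (B n k) ≥ C(m,k+1) · C(k+1,k-1) · 2 ^ (C(m,k) - (m + 2)).
-- For |2k - n| ≤ 2√n the middle estimates 16^h ≤ 4h·C(2h,h)² and
-- C(2h,h) ≤ 2^32·C(2h,h+t) for t = O(√h) give C(m,k+1) ≥ c·2^m/√n, while
-- C(k+1,2) ≥ c·n², which yields mis (B n k) ≥ c·n^(3/2)·2^C(n-1,k).

module Submission where

open import Data.Bool using (Bool; true; false; _∧_; _∨_; not; if_then_else_; T)
open import Data.Bool.Properties using (T-≡; ∧-zeroʳ; ∧-identityʳ; ∨-zeroʳ; ¬-not)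
open import Data.Bool.ListAction using (all; any)
open import Data.Empty using (⊥; ⊥-elim)
open import Data.Fin using (zero; suc)
open import Data.Fin.Subset using (Subset; inside; outside; ∣_∣; _∪_; ⁅_⁆)
  renaming (_∈_ to _∈ₛ_; _∉_ to _∉ₛ_; _⊆_ to _⊆ₛ_; ⊥ to ∅; ⊤ to full)
open import Data.Fin.Subset.Properties
  using (_⊆?_; _∈?_; drop-∷-⊆; out⊆; in⊆in; ⊆-antisym; ⊆-refl; ⊆-min; ⊆-max; p⊆q⇒∣p∣≤∣q∣;
         ∣⊥∣≡0; ∣⊤∣≡n; ∣p∣≤n; x∈p∪q⁺; x∈p∪q⁻; x∈⁅x⁆; x∈⁅y⁆⇒x≡y; p⊆p∪q; ∪-identityʳ)
open import Data.List using (List; []; _∷_; map; _++_; filterᵇ; length; concatMap)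
open import Data.List.Properties using (length-++; length-map; filter-++; filter-none; filter-≐; ∷-injectiveʳ)
open import Data.List.Membership.Propositional using (_∈_; find)
open import Data.List.Membership.Propositional.Properties
  using (∈-filter⁺; ∈-filter⁻; ∈-++⁺ˡ; ∈-++⁺ʳ; ∈-++⁻; ∈-map⁺; ∈-map⁻; ∈-∃++)
open import Data.List.Relation.Binary.Subset.Propositional using (_⊆_)
open import Data.List.Relation.Unary.All as All using ()
import Data.List.Relation.Unary.All.Properties as All
open import Data.List.Relation.Unary.Any as Any using (here; there)
import Data.List.Relation.Unary.Any.Properties as Any
open import Data.List.Relation.Unary.AllPairs using ([]; _∷_)
open import Data.List.Relation.Unary.Unique.Propositional using (Unique)
import Data.List.Relation.Unary.Unique.Propositional.Properties as Unique
open import Data.Nat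
open import Data.Nat.Combinatorics using (_C_; nCk+nC[k+1]≡[n+1]C[k+1]; nC1≡n; nCk≡nC[n∸k])
open import Data.Nat.Properties
open import Algebra.Properties.CommutativeSemigroup *-commutativeSemigroup
  using (x∙yz≈y∙xz; x∙yz≈yx∙z; x∙yz≈xz∙y)
open import Data.Nat.Tactic.RingSolver using (solve-∀)
open import Data.Product using (Σ; _×_; _,_; proj₁; proj₂; ∃-syntax)
open import Data.Product.Properties using (,-injective; ,-injectiveʳ)
open import Data.Sum as Sum using (_⊎_; inj₁; inj₂)
open import Data.Vec using ([]; _∷_; here; there)
open import Data.Vec.Properties using () renaming (∷-injectiveʳ to ∷ᵥ-injectiveʳ)
open import Function using (_∘_; _$_; case_of_; Equivalence)
open import Relation.Binary.PropositionalEquality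
open import Relation.Nullary using (¬_; yes; no)
open import Relation.Nullary.Decidable using (⌊_⌋; T?)
open import Defs

private variable
  A A′ : Set
  m : ℕ

not∨not-intro : ∀ {a b} → (a ≡ true → b ≡ false) → not a ∨ not b ≡ true
not∨not-intro {true}  a⇒¬b rewrite a⇒¬b refl = refl
not∨not-intro {false} _ = refl

∧≡true⁻ : ∀ {a b} → a ∧ b ≡ true → a ≡ true × b ≡ true
∧≡true⁻ {true} {true} _ = refl , refl

not∨not≡true⇒ : ∀ {a b} → a ≡ true → not a ∨ not b ≡ true → b ≡ false
not∨not≡true⇒ {b = false} _ _ = refl
not∨not≡true⇒ {true} {true} _ ()

not∨not≡false⁻ : ∀ {a b} → not a ∨ not b ≡ false → a ≡ true × b ≡ true
not∨not≡false⁻ {true} {true} _ = refl , refl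

module _ (p : A → Bool) where

  ∈-filterᵇ⁺ : ∀ {x xs} → x ∈ xs → p x ≡ true → x ∈ filterᵇ p xs
  ∈-filterᵇ⁺ x∈xs px = ∈-filter⁺ (T? ∘ p) x∈xs (Equivalence.from T-≡ px)

  ∈-filterᵇ⁻ : ∀ {x} xs → x ∈ filterᵇ p xs → x ∈ xs × p x ≡ true
  ∈-filterᵇ⁻ xs x∈ with x∈xs , px ← ∈-filter⁻ (T? ∘ p) {xs = xs} x∈ = x∈xs , Equivalence.to T-≡ px

  all-≡true⁻ : ∀ {x xs} → all p xs ≡ true → x ∈ xs → p x ≡ true
  all-≡true⁻ {xs = xs} e x∈xs =
    Equivalence.to T-≡ (All.lookup (All.all⁺ p xs (Equivalence.from T-≡ e)) x∈xs)

  all-≡true⁺ : ∀ {xs} → (∀ {x} → x ∈ xs → p x ≡ true) → all p xs ≡ true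
  all-≡true⁺ h = Equivalence.to T-≡ (All.all⁻ p (All.tabulate (Equivalence.from T-≡ ∘ h)))

  all-≡false⁻ : ∀ xs → all p xs ≡ false → ∃[ x ] x ∈ xs × p x ≡ false
  all-≡false⁻ (y ∷ xs) e with p y in py
  ... | true  = let x , x∈xs , px = all-≡false⁻ xs e in x , there x∈xs , px
  ... | false = y , here refl , py

  any-≡true⁺ : ∀ {x xs} → x ∈ xs → p x ≡ true → any p xs ≡ true
  any-≡true⁺ x∈xs px = Equivalence.to T-≡ (Any.any⁺ p (Any.map (λ { refl → Equivalence.from T-≡ px }) x∈xs))

  any-≡true⁻ : ∀ xs → any p xs ≡ true → ∃[ x ] x ∈ xs × p x ≡ true
  any-≡true⁻ xs e =
    let x , x∈xs , px = find (Any.any⁻ p xs (Equivalence.from T-≡ e)) in x , x∈xs , Equivalence.to T-≡ px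

  filterᵇ∈sublists : ∀ xs → filterᵇ p xs ∈ sublists xs
  filterᵇ∈sublists [] = here refl
  filterᵇ∈sublists (y ∷ xs) with p y
  ... | true  = ∈-++⁺ˡ (∈-map⁺ (y ∷_) (filterᵇ∈sublists xs))
  ... | false = ∈-++⁺ʳ (map (y ∷_) (sublists xs)) (filterᵇ∈sublists xs)

filterᵇ-≡⇒≡ : ∀ (p q : A → Bool) xs → filterᵇ p xs ≡ filterᵇ q xs → ∀ {x} → x ∈ xs → p x ≡ q x
filterᵇ-≡⇒≡ p q xs e {x} x∈xs with p x in px | q x in qx
... | true  | true  = refl
... | false | false = refl
... | true  | false = sym (trans (sym qx) (proj₂ (∈-filterᵇ⁻ q xs (subst (x ∈_) e (∈-filterᵇ⁺ p x∈xs px)))))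
... | false | true  = trans (sym px) (proj₂ (∈-filterᵇ⁻ p xs (subst (x ∈_) (sym e) (∈-filterᵇ⁺ q x∈xs qx))))

private
  1+[a+b+c]≤a+[1+b]+[1+c] : ∀ a b c → suc (a + b + c) ≤ a + suc b + suc c
  1+[a+b+c]≤a+[1+b]+[1+c] a b c rewrite +-suc a b | +-suc (a + b) c = n≤1+n _

countᵇ : (A → Bool) → List A → ℕ
countᵇ p xs = length (filterᵇ p xs)

neither : (p q : A → Bool) → A → Bool
neither p q x = not (p x) ∧ not (q x)

length-≤-countᵇ-cover : ∀ (p q : A → Bool) xs →
  length xs ≤ countᵇ (neither p q) xs + countᵇ p xs + countᵇ q xs
length-≤-countᵇ-cover p q [] = z≤n
length-≤-countᵇ-cover p q (x ∷ xs) with p x | q x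
... | true  | true  = ≤-trans (s≤s ih) (1+[a+b+c]≤a+[1+b]+[1+c] (countᵇ (neither p q) xs) (countᵇ p xs) (countᵇ q xs))
  where ih = length-≤-countᵇ-cover p q xs
... | true  | false =
  ≤-trans (s≤s ih) (≤-reflexive (sym (cong (_+ countᵇ q xs) (+-suc (countᵇ (neither p q) xs) (countᵇ p xs)))))
  where ih = length-≤-countᵇ-cover p q xs
... | false | true  = ≤-trans (s≤s ih) (≤-reflexive (sym (+-suc (countᵇ (neither p q) xs + countᵇ p xs) (countᵇ q xs))))
  where ih = length-≤-countᵇ-cover p q xs
... | false | false = s≤s (length-≤-countᵇ-cover p q xs)

countᵇ-cong : ∀ {p q : A → Bool} → (∀ x → p x ≡ q x) → ∀ xs → countᵇ p xs ≡ countᵇ q xs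
countᵇ-cong {p = p} {q} p≗q xs =
  cong length (filter-≐ (T? ∘ p) (T? ∘ q) ((λ {x} → subst T (p≗q x)) , (λ {x} → subst T (sym (p≗q x)))) xs)

countᵇ-filterᵇ : ∀ (p q : A → Bool) xs → countᵇ q (filterᵇ p xs) ≡ countᵇ (λ x → p x ∧ q x) xs
countᵇ-filterᵇ p q [] = refl
countᵇ-filterᵇ p q (x ∷ xs) with p x
... | false = countᵇ-filterᵇ p q xs
... | true with q x
...   | true  = cong suc (countᵇ-filterᵇ p q xs)
...   | false = countᵇ-filterᵇ p q xs

countᵇ-map : ∀ (p : A′ → Bool) (f : A → A′) xs → countᵇ p (map f xs) ≡ countᵇ (p ∘ f) xs
countᵇ-map p f [] = refl
countᵇ-map p f (x ∷ xs) with p (f x)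
... | true  = cong suc (countᵇ-map p f xs)
... | false = countᵇ-map p f xs

∈-sublists⇒⊆ : ∀ {xs ys : List A} → ys ∈ sublists xs → ys ⊆ xs
∈-sublists⇒⊆ {xs = []} (here refl) ()
∈-sublists⇒⊆ {xs = x ∷ xs} ys∈ z∈ys with ∈-++⁻ (map (x ∷_) (sublists xs)) ys∈
... | inj₂ ys∈′ = there (∈-sublists⇒⊆ ys∈′ z∈ys)
... | inj₁ x∷ys∈ with ∈-map⁻ (x ∷_) x∷ys∈
...   | ys′ , ys′∈ , refl with z∈ys
...     | here z≡x   = here z≡x
...     | there z∈ys′ = there (∈-sublists⇒⊆ ys′∈ z∈ys′)

Unique-sublists : ∀ {xs : List A} → Unique xs → Unique (sublists xs)
Unique-sublists {xs = []} [] = All.[] ∷ []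
Unique-sublists {xs = x ∷ xs} (x∉xs ∷ uxs) =
  Unique.++⁺ (Unique.map⁺ ∷-injectiveʳ (Unique-sublists uxs)) (Unique-sublists uxs) disjoint
  where
  disjoint : ∀ {ys} → ¬ (ys ∈ map (x ∷_) (sublists xs) × ys ∈ sublists xs)
  disjoint (x∷zs∈ , ys∈) with ∈-map⁻ (x ∷_) x∷zs∈
  ... | zs , _ , refl = All.lookup x∉xs (∈-sublists⇒⊆ ys∈ (here refl)) refl

sublists-≡ : ∀ {xs ys zs : List A} → Unique xs → ys ∈ sublists xs → zs ∈ sublists xs →
  (∀ {x} → x ∈ ys → x ∈ zs) → (∀ {x} → x ∈ zs → x ∈ ys) → ys ≡ zs
sublists-≡ {xs = []} _ (here refl) (here refl) _ _ = refl
sublists-≡ {xs = x ∷ xs} (x∉xs ∷ uxs) ys∈ zs∈ ys⊆zs zs⊆ys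
  with ∈-++⁻ (map (x ∷_) (sublists xs)) ys∈ | ∈-++⁻ (map (x ∷_) (sublists xs)) zs∈
... | inj₁ x∷ys∈ | inj₁ x∷zs∈ with ∈-map⁻ (x ∷_) x∷ys∈ | ∈-map⁻ (x ∷_) x∷zs∈
...   | ys′ , ys′∈ , refl | zs′ , zs′∈ , refl =
  cong (x ∷_) (sublists-≡ uxs ys′∈ zs′∈ (dropHead ys′∈ zs′∈ ys⊆zs) (dropHead zs′∈ ys′∈ zs⊆ys))
  where
  dropHead : ∀ {us vs} → us ∈ sublists xs → vs ∈ sublists xs →
    (∀ {y} → y ∈ x ∷ us → y ∈ x ∷ vs) → ∀ {y} → y ∈ us → y ∈ vs
  dropHead us∈ vs∈ h y∈us with h (there y∈us)
  ... | here refl   = ⊥-elim (All.lookup x∉xs (∈-sublists⇒⊆ us∈ y∈us) refl)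
  ... | there y∈vs = y∈vs
sublists-≡ (x∉xs ∷ _) _ zs∈ ys⊆zs _ | inj₁ x∷ys∈ | inj₂ zs∈′ with ∈-map⁻ _ x∷ys∈
... | _ , _ , refl = ⊥-elim (All.lookup x∉xs (∈-sublists⇒⊆ zs∈′ (ys⊆zs (here refl))) refl)
sublists-≡ (x∉xs ∷ _) ys∈ _ _ zs⊆ys | inj₂ ys∈′ | inj₁ x∷zs∈ with ∈-map⁻ _ x∷zs∈
... | _ , _ , refl = ⊥-elim (All.lookup x∉xs (∈-sublists⇒⊆ ys∈′ (zs⊆ys (here refl))) refl)
sublists-≡ (_ ∷ uxs) _ _ ys⊆zs zs⊆ys | inj₂ ys∈′ | inj₂ zs∈′ = sublists-≡ uxs ys∈′ zs∈′ ys⊆zs zs⊆ys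

length-sublists : ∀ (xs : List A) → length (sublists xs) ≡ 2 ^ length xs
length-sublists [] = refl
length-sublists (x ∷ xs) = begin
  length (map (x ∷_) (sublists xs) ++ sublists xs)   ≡⟨ length-++ (map (x ∷_) (sublists xs)) ⟩
  length (map (x ∷_) (sublists xs)) + length (sublists xs)
                                                     ≡⟨ cong (_+ length (sublists xs)) (length-map (x ∷_) (sublists xs)) ⟩
  length (sublists xs) + length (sublists xs)       ≡⟨ cong (λ n → n + n) (length-sublists xs) ⟩
  2 ^ length xs + 2 ^ length xs                     ≡⟨ cong (2 ^ length xs +_) (sym (+-identityʳ _)) ⟩
  2 ^ length (x ∷ xs)                               ∎
  where open ≡-Reasoning

Unique-map⁺ : ∀ {f : A → A′} {xs} → (∀ {x y} → x ∈ xs → y ∈ xs → f x ≡ f y → x ≡ y) →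
  Unique xs → Unique (map f xs)
Unique-map⁺ {xs = []} _ [] = []
Unique-map⁺ {f = f} {x ∷ xs} inj (x≢xs ∷ uxs) =
  All.map⁺ (All.tabulate fx≢) ∷ Unique-map⁺ (λ y∈ z∈ → inj (there y∈) (there z∈)) uxs
  where
  fx≢ : ∀ {y} → y ∈ xs → f x ≢ f y
  fx≢ y∈xs fx≡fy = All.lookup x≢xs y∈xs (inj (here refl) (there y∈xs) fx≡fy)

private
  ∈-remove : ∀ {x y : A} ys zs → y ∈ ys ++ x ∷ zs → y ≢ x → y ∈ ys ++ zs
  ∈-remove [] zs (here y≡x) y≢x = ⊥-elim (y≢x y≡x)
  ∈-remove [] zs (there y∈zs) _ = y∈zs
  ∈-remove (_ ∷ ys) zs (here refl) _ = here refl
  ∈-remove (_ ∷ ys) zs (there y∈) y≢x = there (∈-remove ys zs y∈ y≢x)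

length-≤-⊆ : ∀ {xs ys : List A} → Unique xs → xs ⊆ ys → length xs ≤ length ys
length-≤-⊆ {xs = []} _ _ = z≤n
length-≤-⊆ {xs = x ∷ xs} (x≢xs ∷ uxs) x∷xs⊆ys with ∈-∃++ (x∷xs⊆ys (here refl))
... | ys₁ , ys₂ , refl = begin
  suc (length xs)          ≤⟨ s≤s (length-≤-⊆ uxs xs⊆ys₁++ys₂) ⟩
  suc (length (ys₁ ++ ys₂)) ≡⟨ cong suc (length-++ ys₁) ⟩
  suc (length ys₁ + length ys₂) ≡⟨ sym (+-suc (length ys₁) _) ⟩
  length ys₁ + length (x ∷ ys₂) ≡⟨ sym (length-++ ys₁) ⟩
  length (ys₁ ++ x ∷ ys₂)  ∎
  where
  open ≤-Reasoning
  xs⊆ys₁++ys₂ : xs ⊆ ys₁ ++ ys₂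
  xs⊆ys₁++ys₂ y∈xs = ∈-remove ys₁ ys₂ (x∷xs⊆ys (there y∈xs)) (λ y≡x → All.lookup x≢xs y∈xs (sym y≡x))

module _ (f : A → List A′) where

  ∈-concatMap⁻ : ∀ xs {z} → z ∈ concatMap f xs → ∃[ x ] x ∈ xs × z ∈ f x
  ∈-concatMap⁻ (x ∷ xs) z∈ with ∈-++⁻ (f x) z∈
  ... | inj₁ z∈fx = x , here refl , z∈fx
  ... | inj₂ z∈rest = let y , y∈xs , z∈fy = ∈-concatMap⁻ xs z∈rest in y , there y∈xs , z∈fy

  Unique-concatMap : ∀ {xs} → Unique xs → (∀ {x} → x ∈ xs → Unique (f x)) →
    (∀ {x y z} → x ∈ xs → y ∈ xs → z ∈ f x → z ∈ f y → x ≡ y) → Unique (concatMap f xs)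
  Unique-concatMap {[]} _ _ _ = []
  Unique-concatMap {x ∷ xs} (x≢xs ∷ uxs) ufx disjoint =
    Unique.++⁺ (ufx (here refl))
      (Unique-concatMap uxs (ufx ∘ there) (λ y∈ z∈ → disjoint (there y∈) (there z∈)))
      λ (z∈fx , z∈rest) → let y , y∈xs , z∈fy = ∈-concatMap⁻ xs z∈rest in
        All.lookup x≢xs y∈xs (disjoint (here refl) (there y∈xs) z∈fx z∈fy)

  length-concatMap-≥ : ∀ xs (c d : ℕ) → (∀ {x} → x ∈ xs → c ≤ length (f x) * d) →
    length xs * c ≤ length (concatMap f xs) * d
  length-concatMap-≥ [] c d _ = z≤n
  length-concatMap-≥ (x ∷ xs) c d h = begin
    c + length xs * c                               ≤⟨ +-mono-≤ (h (here refl)) (length-concatMap-≥ xs c d (h ∘ there)) ⟩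
    length (f x) * d + length (concatMap f xs) * d ≡⟨ sym (*-distribʳ-+ d (length (f x)) _) ⟩
    (length (f x) + length (concatMap f xs)) * d   ≡⟨ cong (_* d) (sym (length-++ (f x))) ⟩
    length (concatMap f (x ∷ xs)) * d              ∎
    where open ≤-Reasoning

-- Binomial coefficients

pascal : ∀ n k → suc n C suc k ≡ n C k + n C suc k
pascal n k = sym (nCk+nC[k+1]≡[n+1]C[k+1] n k)

C-absorption : ∀ n k → (suc n C suc k) * suc k ≡ suc n * (n C k)
C-absorption zero    zero    = refl
C-absorption zero    (suc k) = refl
C-absorption (suc n) zero    = cong (_* 1) (nC1≡n (suc (suc n)))
C-absorption (suc n) (suc k) = begin
  (suc (suc n) C suc (suc k)) * suc (suc k)
    ≡⟨ cong (_* suc (suc k)) (pascal (suc n) (suc k)) ⟩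
  (a + b) * suc (suc k)
    ≡⟨ distribute a b k ⟩
  a * suc k + a + b * suc (suc k)
    ≡⟨ cong₂ (λ x y → x + a + y) (C-absorption n k) (C-absorption n (suc k)) ⟩
  suc n * (n C k) + a + suc n * (n C suc k)
    ≡⟨ cong (λ z → suc n * (n C k) + z + suc n * (n C suc k)) (pascal n k) ⟩
  suc n * (n C k) + (n C k + n C suc k) + suc n * (n C suc k)
    ≡⟨ collect (n C k) (n C suc k) n ⟩
  suc (suc n) * (n C k + n C suc k)
    ≡⟨ cong (suc (suc n) *_) (pascal n k) ⟨
  suc (suc n) * a
    ∎
  where
  open ≡-Reasoning
  a = suc n C suc k
  b = suc n C suc (suc k)
  distribute : ∀ a b k → (a + b) * suc (suc k) ≡ a * suc k + a + b * suc (suc k)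
  distribute = solve-∀
  collect : ∀ x y n → suc n * x + (x + y) + suc n * y ≡ suc (suc n) * (x + y)
  collect = solve-∀

C-ratio : ∀ n k → (n C suc k) * suc k + (n C k) * k ≡ (n C k) * n
C-ratio zero    zero    = refl
C-ratio zero    (suc k) = refl
C-ratio (suc n) zero    = trans (cong (_+ 0) (C-absorption n 0)) (solve n)
  where solve : ∀ n → suc n * 1 + 0 ≡ 1 * suc n
        solve = solve-∀
C-ratio (suc n) (suc k) = begin
  (suc n C suc (suc k)) * suc (suc k) + (suc n C suc k) * suc k
    ≡⟨ cong₂ _+_ (C-absorption n (suc k)) (C-absorption n k) ⟩
  suc n * (n C suc k) + suc n * (n C k)
    ≡⟨ collect (n C k) (n C suc k) n ⟩
  (n C k + n C suc k) * suc n
    ≡⟨ cong (_* suc n) (pascal n k) ⟨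
  (suc n C suc k) * suc n
    ∎
  where
  open ≡-Reasoning
  collect : ∀ x y n → suc n * y + suc n * x ≡ (x + y) * suc n
  collect = solve-∀

C-symmetric : ∀ a b → (a + b) C a ≡ (a + b) C b
C-symmetric a b = trans (nCk≡nC[n∸k] (m≤m+n a b)) (cong ((a + b) C_) (m+n∸m≡n a b))

[1+n]Cn≡1+n : ∀ n → suc n C n ≡ suc n
[1+n]Cn≡1+n n = begin
  suc n C n     ≡⟨ cong (_C n) (+-comm 1 n) ⟩
  (n + 1) C n   ≡⟨ C-symmetric n 1 ⟩
  (n + 1) C 1   ≡⟨ nC1≡n (n + 1) ⟩
  n + 1         ≡⟨ +-comm n 1 ⟩
  suc n         ∎
  where open ≡-Reasoning

-- Subsets of Fin m

-- Structural inclusion test: unlike ⌊ s ⊆? t ⌋ it reduces on cons cells,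
-- which the counting below relies on.
infix 7 _⊆ᵇ_
_⊆ᵇ_ : Subset m → Subset m → Bool
[]            ⊆ᵇ []            = true
(outside ∷ s) ⊆ᵇ (_ ∷ t)       = s ⊆ᵇ t
(inside ∷ s)  ⊆ᵇ (inside ∷ t)  = s ⊆ᵇ t
(inside ∷ s)  ⊆ᵇ (outside ∷ t) = false

⊆ᵇ⇒⊆ : ∀ {s t : Subset m} → s ⊆ᵇ t ≡ true → s ⊆ₛ t
⊆ᵇ⇒⊆ {s = []}          {[]}          _ ()
⊆ᵇ⇒⊆ {s = outside ∷ s} {_ ∷ t}       s⊆t = out⊆ (⊆ᵇ⇒⊆ s⊆t)
⊆ᵇ⇒⊆ {s = inside ∷ s}  {inside ∷ t}  s⊆t = in⊆in (⊆ᵇ⇒⊆ s⊆t)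

⊆⇒⊆ᵇ : ∀ {s t : Subset m} → s ⊆ₛ t → s ⊆ᵇ t ≡ true
⊆⇒⊆ᵇ {s = []}          {[]}          _   = refl
⊆⇒⊆ᵇ {s = outside ∷ s} {_ ∷ t}       s⊆t = ⊆⇒⊆ᵇ (drop-∷-⊆ s⊆t)
⊆⇒⊆ᵇ {s = inside ∷ s}  {inside ∷ t}  s⊆t = ⊆⇒⊆ᵇ (drop-∷-⊆ s⊆t)
⊆⇒⊆ᵇ {s = inside ∷ s}  {outside ∷ t} s⊆t with s⊆t here
... | ()

⌊⊆?⌋≡⊆ᵇ : ∀ (s t : Subset m) → ⌊ s ⊆? t ⌋ ≡ s ⊆ᵇ t
⌊⊆?⌋≡⊆ᵇ s t with s ⊆? t | s ⊆ᵇ t in s⊆ᵇt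
... | yes s⊆t | _     = sym (trans (sym s⊆ᵇt) (⊆⇒⊆ᵇ s⊆t))
... | no  _   | false = refl
... | no  s⊈t | true  = ⊥-elim (s⊈t (⊆ᵇ⇒⊆ s⊆ᵇt))

⊆ᵇ-refl : ∀ (s : Subset m) → s ⊆ᵇ s ≡ true
⊆ᵇ-refl s = ⊆⇒⊆ᵇ {s = s} ⊆-refl

⊆ᵇ-antisym : ∀ {s t : Subset m} → s ⊆ᵇ t ≡ true → t ⊆ᵇ s ≡ true → s ≡ t
⊆ᵇ-antisym s⊆t t⊆s = ⊆-antisym (⊆ᵇ⇒⊆ s⊆t) (⊆ᵇ⇒⊆ t⊆s)

⊆ᵇ⇒∣∣≤ : ∀ {s t : Subset m} → s ⊆ᵇ t ≡ true → ∣ s ∣ ≤ ∣ t ∣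
⊆ᵇ⇒∣∣≤ {s = s} {t} s⊆t = p⊆q⇒∣p∣≤∣q∣ {p = s} {t} (⊆ᵇ⇒⊆ s⊆t)

⊆ᵇ∧∣∣≡⇒≡ : ∀ {s t : Subset m} → s ⊆ᵇ t ≡ true → ∣ s ∣ ≡ ∣ t ∣ → s ≡ t
⊆ᵇ∧∣∣≡⇒≡ {s = []}          {[]}          _   _  = refl
⊆ᵇ∧∣∣≡⇒≡ {s = outside ∷ s} {outside ∷ t} s⊆t eq = cong (outside ∷_) (⊆ᵇ∧∣∣≡⇒≡ s⊆t eq)
⊆ᵇ∧∣∣≡⇒≡ {s = outside ∷ s} {inside ∷ t}  s⊆t eq = ⊥-elim (<-irrefl eq (s≤s (⊆ᵇ⇒∣∣≤ {s = s} s⊆t)))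
⊆ᵇ∧∣∣≡⇒≡ {s = inside ∷ s}  {inside ∷ t}  s⊆t eq = cong (inside ∷_) (⊆ᵇ∧∣∣≡⇒≡ s⊆t (suc-injective eq))

∃-∈-∖ : ∀ {s t : Subset m} → s ⊆ₛ t → ∣ s ∣ < ∣ t ∣ → ∃[ i ] i ∉ₛ s × i ∈ₛ t
∃-∈-∖ {s = outside ∷ s} {inside ∷ t}  _   _ = zero , (λ ()) , here
∃-∈-∖ {s = outside ∷ s} {outside ∷ t} s⊆t lt =
  let i , i∉s , i∈t = ∃-∈-∖ (drop-∷-⊆ s⊆t) lt in suc i , (λ { (there i∈s) → i∉s i∈s }) , there i∈t
∃-∈-∖ {s = inside ∷ s}  {inside ∷ t}  s⊆t (s≤s lt) =
  let i , i∉s , i∈t = ∃-∈-∖ (drop-∷-⊆ s⊆t) lt in suc i , (λ { (there i∈s) → i∉s i∈s }) , there i∈t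
∃-∈-∖ {s = inside ∷ s}  {outside ∷ t} s⊆t _ with s⊆t here
... | ()

∣p∪⁅i⁆∣≡1+∣p∣ : ∀ {p : Subset m} {i} → i ∉ₛ p → ∣ p ∪ ⁅ i ⁆ ∣ ≡ suc ∣ p ∣
∣p∪⁅i⁆∣≡1+∣p∣ {p = outside ∷ p} {zero}  _   = cong (suc ∘ ∣_∣) (∪-identityʳ p)
∣p∪⁅i⁆∣≡1+∣p∣ {p = inside ∷ p}  {zero}  i∉p = ⊥-elim (i∉p here)
∣p∪⁅i⁆∣≡1+∣p∣ {p = outside ∷ p} {suc i} i∉p = ∣p∪⁅i⁆∣≡1+∣p∣ (i∉p ∘ there)
∣p∪⁅i⁆∣≡1+∣p∣ {p = inside ∷ p}  {suc i} i∉p = cong suc (∣p∪⁅i⁆∣≡1+∣p∣ (i∉p ∘ there))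

∈-allSubsets : ∀ (s : Subset m) → s ∈ allSubsets m
∈-allSubsets []            = here refl
∈-allSubsets (inside ∷ s)  = ∈-++⁺ˡ (∈-map⁺ (inside ∷_) (∈-allSubsets s))
∈-allSubsets (outside ∷ s) = ∈-++⁺ʳ (map (inside ∷_) (allSubsets _)) (∈-map⁺ (outside ∷_) (∈-allSubsets s))

Unique-allSubsets : ∀ m → Unique (allSubsets m)
Unique-allSubsets zero    = All.[] ∷ []
Unique-allSubsets (suc m) =
  Unique.++⁺ (Unique.map⁺ ∷ᵥ-injectiveʳ (Unique-allSubsets m)) (Unique.map⁺ ∷ᵥ-injectiveʳ (Unique-allSubsets m))
    λ (in∈ , out∈) → case ∈-map⁻ (inside ∷_) in∈ , ∈-map⁻ (outside ∷_) out∈ of λ where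
      ((_ , _ , refl) , (_ , _ , ())) 

between : Subset m → Subset m → Subset m → Bool
between A B S = A ⊆ᵇ S ∧ S ⊆ᵇ B

hasSize : ℕ → Subset m → Bool
hasSize j S = ∣ S ∣ ≡ᵇ j

hasSize⁻ : ∀ {j} (S : Subset m) → hasSize j S ≡ true → ∣ S ∣ ≡ j
hasSize⁻ S e = ≡ᵇ⇒≡ ∣ S ∣ _ (Equivalence.from T-≡ e)

hasSize⁺ : ∀ {j} (S : Subset m) → ∣ S ∣ ≡ j → hasSize j S ≡ true
hasSize⁺ S e = Equivalence.to T-≡ (≡⇒≡ᵇ ∣ S ∣ _ e)

hasSize-≢ : ∀ {j} (S : Subset m) → ∣ S ∣ ≢ j → hasSize j S ≡ false
hasSize-≢ {j = j} S ne with hasSize j S in e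
... | true  = ⊥-elim (ne (hasSize⁻ S e))
... | false = refl

hasSize≡false⇒≢ : ∀ {j} (S : Subset m) → hasSize j S ≡ false → ∣ S ∣ ≢ j
hasSize≡false⇒≢ S ne eq with () ← trans (sym ne) (hasSize⁺ S eq)

shiftedC : ℕ → ℕ → ℕ → ℕ
shiftedC zero    d j       = d C j
shiftedC (suc a) d zero    = 0
shiftedC (suc a) d (suc j) = shiftedC a d j

shiftedC-zero : ∀ a d → shiftedC a (suc d) 0 ≡ shiftedC a d 0
shiftedC-zero zero    d = refl
shiftedC-zero (suc a) d = refl

shiftedC-pascal : ∀ a d j → shiftedC a (suc d) (suc j) ≡ shiftedC a d j + shiftedC a d (suc j)
shiftedC-pascal zero    d j       = pascal d j
shiftedC-pascal (suc a) d zero    = shiftedC-zero a d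
shiftedC-pascal (suc a) d (suc j) = shiftedC-pascal a d j

shiftedC-+ : ∀ a d r → shiftedC a d (a + r) ≡ d C r
shiftedC-+ zero    d r = refl
shiftedC-+ (suc a) d r = shiftedC-+ a d r

private
  countᵇ-allSubsets-suc : ∀ m (q : Subset (suc m) → Bool) →
    countᵇ q (allSubsets (suc m)) ≡ countᵇ (q ∘ (inside ∷_)) (allSubsets m) + countᵇ (q ∘ (outside ∷_)) (allSubsets m)
  countᵇ-allSubsets-suc m q = begin
    countᵇ q (map (inside ∷_) (allSubsets m) ++ map (outside ∷_) (allSubsets m))
      ≡⟨ cong length (filter-++ (T? ∘ q) (map (inside ∷_) (allSubsets m)) _) ⟩
    length (filterᵇ q (map (inside ∷_) (allSubsets m)) ++ filterᵇ q (map (outside ∷_) (allSubsets m)))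
      ≡⟨ length-++ (filterᵇ q (map (inside ∷_) (allSubsets m))) ⟩
    countᵇ q (map (inside ∷_) (allSubsets m)) + countᵇ q (map (outside ∷_) (allSubsets m))
      ≡⟨ cong₂ _+_ (countᵇ-map q (inside ∷_) (allSubsets m)) (countᵇ-map q (outside ∷_) (allSubsets m)) ⟩
    countᵇ (q ∘ (inside ∷_)) (allSubsets m) + countᵇ (q ∘ (outside ∷_)) (allSubsets m)
      ∎
    where open ≡-Reasoning

  countᵇ-none : ∀ {m} (p : Subset m → Bool) → (∀ S → p S ≡ false) → countᵇ p (allSubsets m) ≡ 0
  countᵇ-none p none = cong length (filter-none (T? ∘ p) {xs = allSubsets _} (All.tabulate λ {S} _ → subst T (none S)))

countᵇ-between : ∀ m (A B : Subset m) j → A ⊆ᵇ B ≡ true →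
  countᵇ (λ S → hasSize j S ∧ between A B S) (allSubsets m) ≡ shiftedC ∣ A ∣ (∣ B ∣ ∸ ∣ A ∣) j
countᵇ-between zero [] [] zero    _ = refl
countᵇ-between zero [] [] (suc j) _ = refl
countᵇ-between (suc m) (a ∷ A) (b ∷ B) j A⊆B =
  trans (countᵇ-allSubsets-suc m _) (split a b j A⊆B)
  where
  rec = countᵇ-between m A B
  split : ∀ a b j → (a ∷ A) ⊆ᵇ (b ∷ B) ≡ true →
    countᵇ (λ S → hasSize j (inside ∷ S) ∧ between (a ∷ A) (b ∷ B) (inside ∷ S)) (allSubsets m)
      + countᵇ (λ S → hasSize j (outside ∷ S) ∧ between (a ∷ A) (b ∷ B) (outside ∷ S)) (allSubsets m)
    ≡ shiftedC ∣ a ∷ A ∣ (∣ b ∷ B ∣ ∸ ∣ a ∷ A ∣) j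
  split outside outside j A⊆B = cong₂ _+_ (countᵇ-none {m} _ λ S →
    trans (cong (hasSize j (inside ∷ S) ∧_) (∧-zeroʳ (A ⊆ᵇ S))) (∧-zeroʳ _)) (rec j A⊆B)
  split outside inside zero A⊆B = trans (cong₂ _+_ (countᵇ-none {m} _ λ _ → refl) (rec 0 A⊆B)) $ begin
    0 + shiftedC (∣ A ∣) ((∣ B ∣) ∸ (∣ A ∣)) 0     ≡⟨ shiftedC-zero (∣ A ∣) _ ⟨
    shiftedC (∣ A ∣) (suc ((∣ B ∣) ∸ (∣ A ∣))) 0   ≡⟨ cong (λ d → shiftedC (∣ A ∣) d 0) (+-∸-assoc 1 (⊆ᵇ⇒∣∣≤ {s = A} A⊆B)) ⟨
    shiftedC (∣ A ∣) (suc (∣ B ∣) ∸ (∣ A ∣)) 0     ∎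
    where open ≡-Reasoning
  split outside inside (suc j) A⊆B = trans (cong₂ _+_ (rec j A⊆B) (rec (suc j) A⊆B)) $ begin
    shiftedC (∣ A ∣) ((∣ B ∣) ∸ (∣ A ∣)) j + shiftedC (∣ A ∣) ((∣ B ∣) ∸ (∣ A ∣)) (suc j)
      ≡⟨ shiftedC-pascal (∣ A ∣) _ j ⟨
    shiftedC (∣ A ∣) (suc ((∣ B ∣) ∸ (∣ A ∣))) (suc j)
      ≡⟨ cong (λ d → shiftedC (∣ A ∣) d (suc j)) (+-∸-assoc 1 (⊆ᵇ⇒∣∣≤ {s = A} A⊆B)) ⟨
    shiftedC (∣ A ∣) (suc (∣ B ∣) ∸ (∣ A ∣)) (suc j)
      ∎
    where open ≡-Reasoning
  split inside inside zero A⊆B =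
    cong₂ _+_ (countᵇ-none {m} _ λ _ → refl) (countᵇ-none {m} _ λ S → ∧-zeroʳ (hasSize 0 (outside ∷ S)))
  split inside inside (suc j) A⊆B =
    trans (cong₂ _+_ (rec j A⊆B) (countᵇ-none {m} _ λ S → ∧-zeroʳ (hasSize (suc j) (outside ∷ S)))) (+-identityʳ _)

countᵇ-⊆ : ∀ m (U : Subset m) j → countᵇ (λ S → hasSize j S ∧ S ⊆ᵇ U) (allSubsets m) ≡ ∣ U ∣ C j
countᵇ-⊆ m U j = begin
  countᵇ (λ S → hasSize j S ∧ S ⊆ᵇ U) (allSubsets m)
    ≡⟨ countᵇ-cong (λ S → cong (λ b → hasSize j S ∧ (b ∧ S ⊆ᵇ U)) (sym (⊆⇒⊆ᵇ {s = ∅} (⊆-min S)))) (allSubsets m) ⟩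
  countᵇ (λ S → hasSize j S ∧ between ∅ U S) (allSubsets m)
    ≡⟨ countᵇ-between m ∅ U j (⊆⇒⊆ᵇ {s = ∅} (⊆-min U)) ⟩
  shiftedC ∣ ∅ {m} ∣ (∣ U ∣ ∸ ∣ ∅ {m} ∣) j
    ≡⟨ cong (λ a → shiftedC a (∣ U ∣ ∸ a) j) (∣⊥∣≡0 m) ⟩
  ∣ U ∣ C j
    ∎
  where open ≡-Reasoning

countᵇ-hasSize : ∀ m j → countᵇ (hasSize j) (allSubsets m) ≡ m C j
countᵇ-hasSize m j = begin
  countᵇ (hasSize j) (allSubsets m)
    ≡⟨ countᵇ-cong (λ S → sym (trans (cong (hasSize j S ∧_) (⊆⇒⊆ᵇ {s = S} (⊆-max S))) (∧-identityʳ _))) (allSubsets m) ⟩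
  countᵇ (λ S → hasSize j S ∧ S ⊆ᵇ full) (allSubsets m)
    ≡⟨ countᵇ-⊆ m full j ⟩
  ∣ full {m} ∣ C j
    ≡⟨ cong (_C j) (∣⊤∣≡n m) ⟩
  m C j
    ∎
  where open ≡-Reasoning

countᵇ-⊇ : ∀ m (T : Subset m) r →
  countᵇ (λ S → hasSize (∣ T ∣ + r) S ∧ T ⊆ᵇ S) (allSubsets m) ≡ (m ∸ ∣ T ∣) C r
countᵇ-⊇ m T r = begin
  countᵇ (λ S → hasSize (∣ T ∣ + r) S ∧ T ⊆ᵇ S) (allSubsets m)
    ≡⟨ countᵇ-cong (λ S → cong (hasSize (∣ T ∣ + r) S ∧_)
         (sym (trans (cong (T ⊆ᵇ S ∧_) (⊆⇒⊆ᵇ {s = S} (⊆-max S))) (∧-identityʳ _)))) (allSubsets m) ⟩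
  countᵇ (λ S → hasSize (∣ T ∣ + r) S ∧ between T full S) (allSubsets m)
    ≡⟨ countᵇ-between m T full (∣ T ∣ + r) (⊆⇒⊆ᵇ {s = T} (⊆-max T)) ⟩
  shiftedC ∣ T ∣ (∣ full {m} ∣ ∸ ∣ T ∣) (∣ T ∣ + r)
    ≡⟨ shiftedC-+ ∣ T ∣ _ r ⟩
  (∣ full {m} ∣ ∸ ∣ T ∣) C r
    ≡⟨ cong (λ n → (n ∸ ∣ T ∣) C r) (∣⊤∣≡n m) ⟩
  (m ∸ ∣ T ∣) C r
    ∎
  where open ≡-Reasoning

between⁻ : ∀ {A B S : Subset m} → between A B S ≡ true → A ⊆ₛ S × S ⊆ₛ B
between⁻ {A = A} {B} {S} e with A ⊆ᵇ S in A⊆S | S ⊆ᵇ B in S⊆B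
... | true | true = ⊆ᵇ⇒⊆ A⊆S , ⊆ᵇ⇒⊆ S⊆B

between⁺ : ∀ {A B S : Subset m} → A ⊆ₛ S → S ⊆ₛ B → between A B S ≡ true
between⁺ A⊆S S⊆B = cong₂ _∧_ (⊆⇒⊆ᵇ A⊆S) (⊆⇒⊆ᵇ S⊆B)

module NestedIntervals {T U T′ U′ : Subset m} (T⊆U : T ⊆ₛ U) (room : 2 + ∣ T ∣ ≤ ∣ U ∣)
         (preserved : ∀ {S} → ∣ S ∣ ≡ suc ∣ T ∣ → T ⊆ₛ S → S ⊆ₛ U → T′ ⊆ₛ S × S ⊆ₛ U′) where

  private
    T∪⁅i⁆⊆U : ∀ {i} → i ∈ₛ U → T ∪ ⁅ i ⁆ ⊆ₛ U
    T∪⁅i⁆⊆U {i} i∈U {x} x∈ with x∈p∪q⁻ T ⁅ i ⁆ x∈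
    ... | inj₁ x∈T   = T⊆U x∈T
    ... | inj₂ x∈⁅i⁆ = subst (_∈ₛ U) (sym (x∈⁅y⁆⇒x≡y i x∈⁅i⁆)) i∈U

    bounds : ∀ {i} → i ∉ₛ T → i ∈ₛ U → T′ ⊆ₛ T ∪ ⁅ i ⁆ × T ∪ ⁅ i ⁆ ⊆ₛ U′
    bounds {i} i∉T i∈U = preserved (∣p∪⁅i⁆∣≡1+∣p∣ i∉T) (p⊆p∪q ⁅ i ⁆) (T∪⁅i⁆⊆U i∈U)

    T′⊆T⊎≡ : ∀ {i x} → i ∉ₛ T → i ∈ₛ U → x ∈ₛ T′ → x ∈ₛ T ⊎ x ≡ i
    T′⊆T⊎≡ {i} i∉T i∈U x∈T′ = Sum.map₂ (x∈⁅y⁆⇒x≡y i) (x∈p∪q⁻ T ⁅ i ⁆ (proj₁ (bounds i∉T i∈U) x∈T′))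

    fresh : ∃[ a ] a ∉ₛ T × a ∈ₛ U
    fresh = ∃-∈-∖ T⊆U (≤-trans (n≤1+n _) room)

    a = proj₁ fresh
    a∉T = proj₁ (proj₂ fresh)
    a∈U = proj₂ (proj₂ fresh)

  ⊆-upper : U ⊆ₛ U′
  ⊆-upper {x} x∈U with x ∈? T
  ... | yes x∈T = proj₂ (bounds a∉T a∈U) (p⊆p∪q ⁅ a ⁆ x∈T)
  ... | no  x∉T = proj₂ (bounds x∉T x∈U) (x∈p∪q⁺ (inj₂ (x∈⁅x⁆ x)))

  ⊇-lower : T′ ⊆ₛ T
  ⊇-lower {x} x∈T′ with x ∈? T
  ... | yes x∈T = x∈T
  ... | no  x∉T with x ∈? U
  ...   | no x∉U = case T′⊆T⊎≡ a∉T a∈U x∈T′ of λ where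
    (inj₁ x∈T)  → ⊥-elim (x∉T x∈T)
    (inj₂ refl) → ⊥-elim (x∉U a∈U)
  ...   | yes x∈U with ∃-∈-∖ (T∪⁅i⁆⊆U x∈U) (subst (_< ∣ U ∣) (sym (∣p∪⁅i⁆∣≡1+∣p∣ x∉T)) room)
  ...     | b , b∉T∪⁅x⁆ , b∈U = case T′⊆T⊎≡ (b∉T∪⁅x⁆ ∘ p⊆p∪q ⁅ x ⁆) b∈U x∈T′ of λ where
    (inj₁ x∈T)  → ⊥-elim (x∉T x∈T)
    (inj₂ refl) → ⊥-elim (b∉T∪⁅x⁆ (x∈p∪q⁺ (inj₂ (x∈⁅x⁆ x))))

between-injective : ∀ {k} {T U T′ U′ : Subset m} →
  T ⊆ₛ U → suc ∣ T ∣ ≡ k → ∣ U ∣ ≡ suc k → T′ ⊆ₛ U′ → suc ∣ T′ ∣ ≡ k → ∣ U′ ∣ ≡ suc k →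
  (∀ S → ∣ S ∣ ≡ k → between T U S ≡ between T′ U′ S) → T ≡ T′ × U ≡ U′
between-injective {T = T} {U} {T′} {U′} T⊆U ∣T∣ ∣U∣ T′⊆U′ ∣T′∣ ∣U′∣ same =
  ⊆-antisym Bwd.⊇-lower Fwd.⊇-lower , ⊆-antisym Fwd.⊆-upper Bwd.⊆-upper
  where
  room : ∀ {k} (A B : Subset m) → suc ∣ A ∣ ≡ k → ∣ B ∣ ≡ suc k → 2 + ∣ A ∣ ≤ ∣ B ∣
  room _ _ ∣A∣ ∣B∣ = ≤-reflexive (trans (cong suc ∣A∣) (sym ∣B∣))
  preserved : ∀ {k} (A B A′ B′ : Subset m) → suc ∣ A ∣ ≡ k →
    (∀ S → ∣ S ∣ ≡ k → between A B S ≡ between A′ B′ S) →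
    ∀ {S} → ∣ S ∣ ≡ suc ∣ A ∣ → A ⊆ₛ S → S ⊆ₛ B → A′ ⊆ₛ S × S ⊆ₛ B′
  preserved _ _ _ _ ∣A∣ same′ {S} ∣S∣ A⊆S S⊆B =
    between⁻ (trans (sym (same′ S (trans ∣S∣ ∣A∣))) (between⁺ A⊆S S⊆B))
  module Fwd = NestedIntervals T⊆U (room T U ∣T∣ ∣U∣) (preserved T U T′ U′ ∣T∣ same)
  module Bwd = NestedIntervals T′⊆U′ (room T′ U′ ∣T′∣ ∣U′∣) (preserved T′ U′ T U ∣T′∣ λ S ∣S∣ → sym (same S ∣S∣))

-- The graph B and its maximal independent sets

∈-levelVerts⁺ : ∀ {k} {v : Subset m} → ∣ v ∣ ≡ k ⊎ ∣ v ∣ ≡ suc k → v ∈ levelVerts m k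
∈-levelVerts⁺ {k = k} {v} (inj₁ e) =
  ∈-filterᵇ⁺ _ (∈-allSubsets v) (cong (_∨ hasSize (suc k) v) (hasSize⁺ v e))
∈-levelVerts⁺ {k = k} {v} (inj₂ e) =
  ∈-filterᵇ⁺ _ (∈-allSubsets v) (trans (cong (hasSize k v ∨_) (hasSize⁺ v e)) (∨-zeroʳ _))

∈-levelVerts⁻ : ∀ {k} {v : Subset m} → v ∈ levelVerts m k → ∣ v ∣ ≡ k ⊎ ∣ v ∣ ≡ suc k
∈-levelVerts⁻ {k = k} {v} v∈ with hasSize k v in e₁ | hasSize (suc k) v in e₂ | proj₂ (∈-filterᵇ⁻ _ (allSubsets _) v∈)
... | true  | _    | _ = inj₁ (hasSize⁻ v e₁)
... | false | true | _ = inj₂ (hasSize⁻ v e₂)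

module _ (k : ℕ) (u v : Subset m) where
  open FinGraph (B m k)

  adj⁺ : ∣ u ∣ ≢ ∣ v ∣ → u ⊆ᵇ v ≡ true ⊎ v ⊆ᵇ u ≡ true → adj u v ≡ true
  adj⁺ ne incl rewrite hasSize-≢ u ne | ⌊⊆?⌋≡⊆ᵇ u v | ⌊⊆?⌋≡⊆ᵇ v u with incl
  ... | inj₁ u⊆v rewrite u⊆v = refl
  ... | inj₂ v⊆u rewrite v⊆u = ∨-zeroʳ _

  adj⁻ : adj u v ≡ true → ∣ u ∣ ≢ ∣ v ∣ × (u ⊆ᵇ v ≡ true ⊎ v ⊆ᵇ u ≡ true)
  adj⁻ e rewrite ⌊⊆?⌋≡⊆ᵇ u v | ⌊⊆?⌋≡⊆ᵇ v u with hasSize ∣ v ∣ u in same | u ⊆ᵇ v | v ⊆ᵇ u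
  ... | false | true  | _    = hasSize≡false⇒≢ u same , inj₁ refl
  ... | false | false | true = hasSize≡false⇒≢ u same , inj₂ refl

==-refl : ∀ k (v : Subset m) → FinGraph._==_ (B m k) v v ≡ true
==-refl k v rewrite ⌊⊆?⌋≡⊆ᵇ v v | ⊆ᵇ-refl v = refl

levelSets : ∀ m → ℕ → List (Subset m)
levelSets m k = filterᵇ (hasSize k) (allSubsets m)

free : ∀ {m} → ℕ → Subset m → Subset m → List (Subset m)
free {m} k T U = filterᵇ (neither (T ⊆ᵇ_) (_⊆ᵇ U)) (levelSets m k)

-- The vertex b ∷ s of B (suc m) k is the set s, together with the new point
-- when b = inside; low S and high S say that the k-set S enters I as S and as
-- S ∪ {0} respectively.
module MIS {m} (k : ℕ) (T U : Subset m) (𝒜 : List (Subset m)) where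

  level : List (Subset m)
  level = levelSets m k

  _∈ᵇ𝒜 : Subset m → Bool
  S ∈ᵇ𝒜 = any (λ S′ → S ⊆ᵇ S′ ∧ S′ ⊆ᵇ S) 𝒜

  low : Subset m → Bool
  low S = not (between T U S) ∧ (T ⊆ᵇ S ∨ (not (S ⊆ᵇ U) ∧ S ∈ᵇ𝒜))

  high : Subset m → Bool
  high S = not (between T U S) ∧ not (low S)

  noLowBelow : Subset m → Bool
  noLowBelow s = all (λ S → not (S ⊆ᵇ s) ∨ not (low S)) level

  noHighAbove : Subset m → Bool
  noHighAbove s = all (λ S → not (s ⊆ᵇ S) ∨ not (high S)) level

  chosen : Subset (suc m) → Bool
  chosen (outside ∷ s) = if hasSize k s then low s else noLowBelow s
  chosen (inside ∷ s)  = if hasSize k s then high s else noHighAbove s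

  I : List (Subset (suc m))
  I = filterᵇ chosen (levelVerts (suc m) k)

  chosen-low : ∀ {s} → ∣ s ∣ ≡ k → chosen (outside ∷ s) ≡ low s
  chosen-low {s} e rewrite hasSize⁺ s e = refl

  chosen-noLowBelow : ∀ {s} → ∣ s ∣ ≢ k → chosen (outside ∷ s) ≡ noLowBelow s
  chosen-noLowBelow {s} e rewrite hasSize-≢ s e = refl

  chosen-high : ∀ {s} → ∣ s ∣ ≡ k → chosen (inside ∷ s) ≡ high s
  chosen-high {s} e rewrite hasSize⁺ s e = refl

  chosen-noHighAbove : ∀ {s} → ∣ s ∣ ≢ k → chosen (inside ∷ s) ≡ noHighAbove s
  chosen-noHighAbove {s} e rewrite hasSize-≢ s e = refl

  ∈-level⁺ : ∀ {S} → ∣ S ∣ ≡ k → S ∈ level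
  ∈-level⁺ {S} e = ∈-filterᵇ⁺ (hasSize k) (∈-allSubsets S) (hasSize⁺ S e)

  ∈-level⁻ : ∀ {S} → S ∈ level → ∣ S ∣ ≡ k
  ∈-level⁻ {S} S∈ = hasSize⁻ S (proj₂ (∈-filterᵇ⁻ (hasSize k) (allSubsets m) S∈))

  noLowBelow⁻ : ∀ {s S} → noLowBelow s ≡ true → ∣ S ∣ ≡ k → S ⊆ᵇ s ≡ true → low S ≡ false
  noLowBelow⁻ none ∣S∣ S⊆s = not∨not≡true⇒ S⊆s (all-≡true⁻ _ none (∈-level⁺ ∣S∣))

  noHighAbove⁻ : ∀ {s S} → noHighAbove s ≡ true → ∣ S ∣ ≡ k → s ⊆ᵇ S ≡ true → high S ≡ false
  noHighAbove⁻ none ∣S∣ s⊆S = not∨not≡true⇒ s⊆S (all-≡true⁻ _ none (∈-level⁺ ∣S∣))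

  ⊆U⇒¬low : ∀ S → S ⊆ᵇ U ≡ true → low S ≡ false
  ⊆U⇒¬low S S⊆U rewrite S⊆U with T ⊆ᵇ S
  ... | true  = refl
  ... | false = refl

  T⊆⇒¬high : ∀ S → T ⊆ᵇ S ≡ true → high S ≡ false
  T⊆⇒¬high S T⊆S rewrite T⊆S with S ⊆ᵇ U
  ... | true  = refl
  ... | false = refl

  between≡¬low∧¬high : ∀ S → between T U S ≡ not (low S) ∧ not (high S)
  between≡¬low∧¬high S with between T U S
  ... | true  = refl
  ... | false with T ⊆ᵇ S ∨ (not (S ⊆ᵇ U) ∧ S ∈ᵇ𝒜)
  ...   | true  = refl
  ...   | false = refl

  low-free : ∀ S → T ⊆ᵇ S ≡ false → S ⊆ᵇ U ≡ false → low S ≡ S ∈ᵇ𝒜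
  low-free S T⊈S S⊈U rewrite T⊈S | S⊈U = refl

  ∈ᵇ𝒜⁺ : ∀ {S} → S ∈ 𝒜 → S ∈ᵇ𝒜 ≡ true
  ∈ᵇ𝒜⁺ {S} S∈𝒜 = any-≡true⁺ _ S∈𝒜 (cong₂ _∧_ (⊆ᵇ-refl S) (⊆ᵇ-refl S))

  ∈ᵇ𝒜⁻ : ∀ {S} → S ∈ᵇ𝒜 ≡ true → S ∈ 𝒜
  ∈ᵇ𝒜⁻ {S} e with S′ , S′∈𝒜 , S≡S′ ← any-≡true⁻ _ 𝒜 e with S⊆S′ , S′⊆S ← ∧≡true⁻ S≡S′
    rewrite ⊆ᵇ-antisym {s = S} S⊆S′ S′⊆S = S′∈𝒜

  ¬low∧high : ∀ S → low S ≡ true → high S ≡ false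
  ¬low∧high S lowS rewrite lowS = ∧-zeroʳ _

  ¬between∧¬low⇒high : ∀ S → between T U S ≡ false → low S ≡ false → high S ≡ true
  ¬between∧¬low⇒high S e₁ e₂ rewrite e₁ | e₂ = refl

  ¬between∧¬high⇒low : ∀ S → between T U S ≡ false → high S ≡ false → low S ≡ true
  ¬between∧¬high⇒low S e₁ e₂ with low S in e₃
  ... | true  = refl
  ... | false with () ← trans (sym e₂) (cong (λ b → not b ∧ true) e₁)

  module Valid (∣T∣ : suc ∣ T ∣ ≡ k) (∣U∣ : ∣ U ∣ ≡ suc k) (T⊆U : T ⊆ᵇ U ≡ true) where
    open FinGraph (B (suc m) k) using (adj; _==_)

    ∈I : ∀ {w} → ∣ w ∣ ≡ k ⊎ ∣ w ∣ ≡ suc k → chosen w ≡ true → w ∈ I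
    ∈I size chosen-w = ∈-filterᵇ⁺ chosen (∈-levelVerts⁺ size) chosen-w

    U∈I : outside ∷ U ∈ I
    U∈I = ∈I (inj₂ ∣U∣) (trans (chosen-noLowBelow (λ e → 1+n≢n (trans (sym ∣U∣) e)))
      (all-≡true⁺ _ {level} λ {S} _ → not∨not-intro (⊆U⇒¬low S)))

    T∪0∈I : inside ∷ T ∈ I
    T∪0∈I = ∈I (inj₁ ∣T∣) (trans (chosen-noHighAbove (λ e → 1+n≢n (trans ∣T∣ (sym e))))
      (all-≡true⁺ _ {level} λ {S} _ → not∨not-intro (T⊆⇒¬high S)))

    private
      k≢1+k : ∀ {a b} → a ≡ k → b ≡ suc k → a ≢ b
      k≢1+k a≡k b≡1+k a≡b = 1+n≢n (trans (sym b≡1+k) (trans (sym a≡b) a≡k))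

    chosen-∈I : ∀ {w} → w ∈ I → chosen w ≡ true
    chosen-∈I w∈ = proj₂ (∈-filterᵇ⁻ chosen (levelVerts (suc m) k) w∈)

    no-edge : ∀ {u v} → u ∈ I → v ∈ I → ∣ u ∣ ≡ k → ∣ v ∣ ≡ suc k → u ⊆ᵇ v ≡ true → ⊥
    no-edge {outside ∷ s} {outside ∷ t} u∈ v∈ ∣s∣ ∣t∣ s⊆t
      with () ← trans (sym (trans (sym (chosen-low ∣s∣)) (chosen-∈I u∈)))
                      (noLowBelow⁻ {s = t} (trans (sym (chosen-noLowBelow (k≢1+k refl ∣t∣ ∘ sym))) (chosen-∈I v∈)) ∣s∣ s⊆t)
    no-edge {outside ∷ s} {inside ∷ t} u∈ v∈ ∣s∣ ∣t∣ s⊆t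
      with refl ← ⊆ᵇ∧∣∣≡⇒≡ {s = s} s⊆t (trans ∣s∣ (sym (suc-injective ∣t∣)))
      with () ← trans (sym (¬low∧high s (trans (sym (chosen-low ∣s∣)) (chosen-∈I u∈))))
                      (trans (sym (chosen-high ∣s∣)) (chosen-∈I v∈))
    no-edge {inside ∷ s} {inside ∷ t} u∈ v∈ ∣s∣ ∣t∣ s⊆t
      with () ← trans (sym (trans (sym (chosen-high (suc-injective ∣t∣))) (chosen-∈I v∈)))
                      (noHighAbove⁻ {s = s}
                        (trans (sym (chosen-noHighAbove (λ e → 1+n≢n (trans (cong suc (sym e)) ∣s∣)))) (chosen-∈I u∈))
                        (suc-injective ∣t∣) s⊆t)

    ∈I⇒∈levelVerts : ∀ {w} → w ∈ I → w ∈ levelVerts (suc m) k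
    ∈I⇒∈levelVerts w∈ = proj₁ (∈-filterᵇ⁻ chosen (levelVerts (suc m) k) w∈)

    no-comparable : ∀ {u v} → u ∈ I → v ∈ I → ∣ u ∣ ≢ ∣ v ∣ → u ⊆ᵇ v ≡ true → ⊥
    no-comparable {u} {v} u∈ v∈ ne u⊆v
      with ∈-levelVerts⁻ (∈I⇒∈levelVerts u∈) | ∈-levelVerts⁻ (∈I⇒∈levelVerts v∈)
    ... | inj₁ ∣u∣ | inj₁ ∣v∣ = ne (trans ∣u∣ (sym ∣v∣))
    ... | inj₂ ∣u∣ | inj₂ ∣v∣ = ne (trans ∣u∣ (sym ∣v∣))
    ... | inj₁ ∣u∣ | inj₂ ∣v∣ = no-edge u∈ v∈ ∣u∣ ∣v∣ u⊆v
    ... | inj₂ ∣u∣ | inj₁ ∣v∣ = 1+n≰n (subst₂ _≤_ ∣u∣ ∣v∣ (⊆ᵇ⇒∣∣≤ {s = u} u⊆v))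

    I-independent : isIndependent (B (suc m) k) I ≡ true
    I-independent = all-≡true⁺ _ λ {u} u∈ → all-≡true⁺ _ λ {v} v∈ → cong not (¬-not λ adj≡true →
      case adj⁻ k u v adj≡true of λ where
        (ne , inj₁ u⊆v) → no-comparable u∈ v∈ ne u⊆v
        (ne , inj₂ v⊆u) → no-comparable v∈ u∈ (ne ∘ sym) v⊆u)

    dominated-S : ∀ {s} → ∣ s ∣ ≡ k → low s ≡ false → ∃[ w ] w ∈ I × adj (outside ∷ s) w ≡ true
    dominated-S {s} ∣s∣ ¬low = by-cases (between T U s) refl
      where
      by-cases : ∀ b → between T U s ≡ b → ∃[ w ] w ∈ I × adj (outside ∷ s) w ≡ true
      by-cases true  e = outside ∷ U , U∈I , adj⁺ k (outside ∷ s) (outside ∷ U) (k≢1+k ∣s∣ ∣U∣) (inj₁ (proj₂ (∧≡true⁻ e)))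
      by-cases false e = inside ∷ s ,
        ∈I (inj₂ (cong suc ∣s∣)) (trans (chosen-high ∣s∣) (¬between∧¬low⇒high s e ¬low)) ,
        adj⁺ k (outside ∷ s) (inside ∷ s) (1+n≢n ∘ sym) (inj₁ (⊆ᵇ-refl s))

    dominated-S∪0 : ∀ {s} → ∣ s ∣ ≡ k → high s ≡ false → ∃[ w ] w ∈ I × adj (inside ∷ s) w ≡ true
    dominated-S∪0 {s} ∣s∣ ¬high = by-cases (between T U s) refl
      where
      by-cases : ∀ b → between T U s ≡ b → ∃[ w ] w ∈ I × adj (inside ∷ s) w ≡ true
      by-cases true  e = inside ∷ T , T∪0∈I ,
        adj⁺ k (inside ∷ s) (inside ∷ T) (k≢1+k ∣T∣ (cong suc ∣s∣) ∘ sym) (inj₂ (proj₁ (∧≡true⁻ e)))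
      by-cases false e = outside ∷ s ,
        ∈I (inj₁ ∣s∣) (trans (chosen-low ∣s∣) (¬between∧¬high⇒low s e ¬high)) ,
        adj⁺ k (inside ∷ s) (outside ∷ s) 1+n≢n (inj₂ (⊆ᵇ-refl s))

    dominated : ∀ {v} → v ∈ levelVerts (suc m) k → chosen v ≡ false → ∃[ w ] w ∈ I × adj v w ≡ true
    dominated {outside ∷ s} v∈ ¬chosen with ∈-levelVerts⁻ v∈
    ... | inj₁ ∣s∣ = dominated-S ∣s∣ (trans (sym (chosen-low ∣s∣)) ¬chosen)
    ... | inj₂ ∣s∣
      with S , S∈ , e ← all-≡false⁻ _ level (trans (sym (chosen-noLowBelow (k≢1+k refl ∣s∣ ∘ sym))) ¬chosen)
      with S⊆s , lowS ← not∨not≡false⁻ e =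
      outside ∷ S , ∈I (inj₁ (∈-level⁻ S∈)) (trans (chosen-low (∈-level⁻ S∈)) lowS) ,
      adj⁺ k (outside ∷ s) (outside ∷ S) (k≢1+k (∈-level⁻ S∈) ∣s∣ ∘ sym) (inj₂ S⊆s)
    dominated {inside ∷ s} v∈ ¬chosen with ∈-levelVerts⁻ v∈
    ... | inj₂ ∣s∣ = dominated-S∪0 (suc-injective ∣s∣) (trans (sym (chosen-high (suc-injective ∣s∣))) ¬chosen)
    ... | inj₁ ∣s∣
      with S , S∈ , e ← all-≡false⁻ _ level
                          (trans (sym (chosen-noHighAbove (λ e → 1+n≢n (trans (cong suc (sym e)) ∣s∣)))) ¬chosen)
      with s⊆S , highS ← not∨not≡false⁻ e =
      inside ∷ S , ∈I (inj₂ (cong suc (∈-level⁻ S∈))) (trans (chosen-high (∈-level⁻ S∈)) highS) ,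
      adj⁺ k (inside ∷ s) (inside ∷ S) (k≢1+k ∣s∣ (cong suc (∈-level⁻ S∈))) (inj₁ s⊆S)

    I-maximal : isMaximal (B (suc m) k) I ≡ true
    I-maximal = all-≡true⁺ _ covered
      where
      covered : ∀ {v} → v ∈ levelVerts (suc m) k → (any (v ==_) I ∨ any (adj v) I) ≡ true
      covered {v} v∈ with chosen v in chosen-v
      ... | true  = cong (_∨ any (adj v) I) (any-≡true⁺ _ (∈I (∈-levelVerts⁻ v∈) chosen-v) (==-refl k v))
      ... | false = let w , w∈ , adj-vw = dominated v∈ chosen-v in
                    trans (cong (any (v ==_) I ∨_) (any-≡true⁺ _ w∈ adj-vw)) (∨-zeroʳ _)

    I-isMIS : isMIS (B (suc m) k) I ≡ true
    I-isMIS = cong₂ _∧_ I-independent I-maximal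

∈free⁻ : ∀ {k} {T U S : Subset m} → S ∈ free k T U → ∣ S ∣ ≡ k × T ⊆ᵇ S ≡ false × S ⊆ᵇ U ≡ false
∈free⁻ {m} {k} {T} {U} {S} S∈ with S∈level , e ← ∈-filterᵇ⁻ _ (levelSets m k) S∈
  with T ⊆ᵇ S | S ⊆ᵇ U | e
... | false | false | _ = hasSize⁻ S (proj₂ (∈-filterᵇ⁻ (hasSize k) (allSubsets m) S∈level)) , refl , refl

Unique-free : ∀ k (T U : Subset m) → Unique (free k T U)
Unique-free {m} k T U = Unique.filter⁺ _ (Unique.filter⁺ _ (Unique-allSubsets m))

module _ {m k} {T U T′ U′ : Subset m} {𝒜 𝒜′ : List (Subset m)}
         (same : MIS.I k T U 𝒜 ≡ MIS.I k T′ U′ 𝒜′) where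
  private
    module M  = MIS k T U 𝒜
    module M′ = MIS k T′ U′ 𝒜′

    same-chosen : ∀ {S} → ∣ S ∣ ≡ k → ∀ b → M.chosen (b ∷ S) ≡ M′.chosen (b ∷ S)
    same-chosen {S} ∣S∣ b = filterᵇ-≡⇒≡ M.chosen M′.chosen _ same {b ∷ S} (∈-levelVerts⁺ {v = b ∷ S} (size b))
      where
      size : ∀ b → ∣ b ∷ S ∣ ≡ k ⊎ ∣ b ∷ S ∣ ≡ suc k
      size outside = inj₁ ∣S∣
      size inside  = inj₂ (cong suc ∣S∣)

  same-low : ∀ S → ∣ S ∣ ≡ k → M.low S ≡ M′.low S
  same-low S ∣S∣ = trans (sym (M.chosen-low ∣S∣)) (trans (same-chosen ∣S∣ outside) (M′.chosen-low ∣S∣))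

  same-high : ∀ S → ∣ S ∣ ≡ k → M.high S ≡ M′.high S
  same-high S ∣S∣ = trans (sym (M.chosen-high ∣S∣)) (trans (same-chosen ∣S∣ inside) (M′.chosen-high ∣S∣))

  same-between : ∀ S → ∣ S ∣ ≡ k → between T U S ≡ between T′ U′ S
  same-between S ∣S∣ = begin
    between T U S                  ≡⟨ M.between≡¬low∧¬high S ⟩
    not (M.low S) ∧ not (M.high S)   ≡⟨ cong₂ (λ a b → not a ∧ not b) (same-low S ∣S∣) (same-high S ∣S∣) ⟩
    not (M′.low S) ∧ not (M′.high S) ≡⟨ M′.between≡¬low∧¬high S ⟨
    between T′ U′ S                ∎
    where open ≡-Reasoning

MIS-injective : ∀ {m k} {T U T′ U′ : Subset m} {𝒜 𝒜′ : List (Subset m)} →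
  suc ∣ T ∣ ≡ k → ∣ U ∣ ≡ suc k → T ⊆ᵇ U ≡ true →
  suc ∣ T′ ∣ ≡ k → ∣ U′ ∣ ≡ suc k → T′ ⊆ᵇ U′ ≡ true →
  𝒜 ∈ sublists (free k T U) → 𝒜′ ∈ sublists (free k T′ U′) →
  MIS.I k T U 𝒜 ≡ MIS.I k T′ U′ 𝒜′ → (T , U , 𝒜) ≡ (T′ , U′ , 𝒜′)
MIS-injective {k = k} {T} {U} {T′} {U′} ∣T∣ ∣U∣ T⊆U ∣T′∣ ∣U′∣ T′⊆U′ 𝒜∈ 𝒜′∈ same
  with refl , refl ← between-injective {T = T} {U} {T′} {U′}
                       (⊆ᵇ⇒⊆ T⊆U) ∣T∣ ∣U∣ (⊆ᵇ⇒⊆ T′⊆U′) ∣T′∣ ∣U′∣ (same-between same) =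
  cong (λ 𝒜 → T , U , 𝒜) (sublists-≡ (Unique-free k T U) 𝒜∈ 𝒜′∈
    (transfer 𝒜∈ (same-low same)) (transfer 𝒜′∈ λ S ∣S∣ → sym (same-low same S ∣S∣)))
  where
  transfer : ∀ {ℬ ℬ′} → ℬ ∈ sublists (free k T U) → (∀ S → ∣ S ∣ ≡ k → MIS.low k T U ℬ S ≡ MIS.low k T U ℬ′ S) →
    ∀ {S} → S ∈ ℬ → S ∈ ℬ′
  transfer {ℬ} {ℬ′} ℬ∈ same-low′ {S} S∈ℬ with ∣S∣ , T⊈S , S⊈U ← ∈free⁻ {T = T} {U} (∈-sublists⇒⊆ ℬ∈ S∈ℬ) =
    MIS.∈ᵇ𝒜⁻ k T U ℬ′ (begin
      MIS._∈ᵇ𝒜 k T U ℬ′ S  ≡⟨ MIS.low-free k T U ℬ′ S T⊈S S⊈U ⟨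
      MIS.low k T U ℬ′ S   ≡⟨ same-low′ S ∣S∣ ⟨
      MIS.low k T U ℬ S    ≡⟨ MIS.low-free k T U ℬ S T⊈S S⊈U ⟩
      MIS._∈ᵇ𝒜 k T U ℬ S   ≡⟨ MIS.∈ᵇ𝒜⁺ k T U ℬ S∈ℬ ⟩
      true                 ∎)
    where open ≡-Reasoning

-- Counting the maximal independent sets

subsetsOf : Subset m → ℕ → List (Subset m)
subsetsOf {m} U j = filterᵇ (λ T → hasSize j T ∧ T ⊆ᵇ U) (allSubsets m)

free-≥ : ∀ {k} (T U : Subset m) → ∣ T ∣ ≡ k → ∣ U ∣ ≡ 2 + k →
  m C suc k ≤ length (free (suc k) T U) + (m + 2)
free-≥ {m} {k} T U ∣T∣ ∣U∣ = begin
  m C suc k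
    ≡⟨ countᵇ-hasSize m (suc k) ⟨
  length (levelSets m (suc k))
    ≤⟨ length-≤-countᵇ-cover (T ⊆ᵇ_) (_⊆ᵇ U) (levelSets m (suc k)) ⟩
  length (free (suc k) T U) + countᵇ (T ⊆ᵇ_) (levelSets m (suc k)) + countᵇ (_⊆ᵇ U) (levelSets m (suc k))
    ≡⟨ cong₂ (λ a b → length (free (suc k) T U) + a + b) supersets subsets ⟩
  length (free (suc k) T U) + (m ∸ k) + (2 + k)
    ≡⟨ +-assoc (length (free (suc k) T U)) (m ∸ k) (2 + k) ⟩
  length (free (suc k) T U) + ((m ∸ k) + (2 + k))
    ≡⟨ cong (length (free (suc k) T U) +_) (trans (+-comm (m ∸ k) (2 + k)) (cong (2 +_) (m+[n∸m]≡n k≤m))) ⟩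
  length (free (suc k) T U) + (2 + m)
    ≡⟨ cong (length (free (suc k) T U) +_) (+-comm 2 m) ⟩
  length (free (suc k) T U) + (m + 2)
    ∎
  where
  open ≤-Reasoning
  k≤m : k ≤ m
  k≤m = subst (_≤ m) ∣T∣ (∣p∣≤n T)
  supersets : countᵇ (T ⊆ᵇ_) (levelSets m (suc k)) ≡ m ∸ k
  supersets = begin-equality
    countᵇ (T ⊆ᵇ_) (levelSets m (suc k))
      ≡⟨ countᵇ-filterᵇ (hasSize (suc k)) (T ⊆ᵇ_) (allSubsets m) ⟩
    countᵇ (λ S → hasSize (suc k) S ∧ T ⊆ᵇ S) (allSubsets m)
      ≡⟨ countᵇ-cong (λ S → cong (λ j → hasSize j S ∧ T ⊆ᵇ S) (trans (cong suc (sym ∣T∣)) (+-comm 1 ∣ T ∣))) (allSubsets m) ⟩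
    countᵇ (λ S → hasSize (∣ T ∣ + 1) S ∧ T ⊆ᵇ S) (allSubsets m)
      ≡⟨ countᵇ-⊇ m T 1 ⟩
    (m ∸ ∣ T ∣) C 1
      ≡⟨ nC1≡n (m ∸ ∣ T ∣) ⟩
    m ∸ ∣ T ∣
      ≡⟨ cong (m ∸_) ∣T∣ ⟩
    m ∸ k
      ∎
  subsets : countᵇ (_⊆ᵇ U) (levelSets m (suc k)) ≡ 2 + k
  subsets = begin-equality
    countᵇ (_⊆ᵇ U) (levelSets m (suc k))
      ≡⟨ countᵇ-filterᵇ (hasSize (suc k)) (_⊆ᵇ U) (allSubsets m) ⟩
    countᵇ (λ S → hasSize (suc k) S ∧ S ⊆ᵇ U) (allSubsets m)
      ≡⟨ countᵇ-⊆ m U (suc k) ⟩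
    ∣ U ∣ C suc k
      ≡⟨ cong (_C suc k) ∣U∣ ⟩
    (2 + k) C suc k
      ≡⟨ [1+n]Cn≡1+n (suc k) ⟩
    2 + k
      ∎

Triple : ℕ → Set
Triple m = Subset m × Subset m × List (Subset m)

IsTriple : ℕ → Triple m → Set
IsTriple k (T , U , 𝒜) = ∣ T ∣ ≡ k × ∣ U ∣ ≡ 2 + k × T ⊆ᵇ U ≡ true × 𝒜 ∈ sublists (free (suc k) T U)

private
  withFamilies : ℕ → Subset m → Subset m → List (Triple m)
  withFamilies k U T = map (λ 𝒜 → T , U , 𝒜) (sublists (free (suc k) T U))

  withLowers : ℕ → Subset m → List (Triple m)
  withLowers k U = concatMap (withFamilies k U) (subsetsOf U k)

triples : ∀ m → ℕ → List (Triple m)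
triples m k = concatMap (withLowers k) (levelSets m (2 + k))

private
  ∈-withFamilies⁻ : ∀ {k} {U T : Subset m} {z} → z ∈ withFamilies k U T →
    ∃[ 𝒜 ] z ≡ (T , U , 𝒜) × 𝒜 ∈ sublists (free (suc k) T U)
  ∈-withFamilies⁻ z∈ with 𝒜 , 𝒜∈ , refl ← ∈-map⁻ _ z∈ = 𝒜 , refl , 𝒜∈

  ∈-withLowers⁻ : ∀ {k} {U : Subset m} {z} → z ∈ withLowers k U →
    ∃[ T ] ∃[ 𝒜 ] z ≡ (T , U , 𝒜) × ∣ T ∣ ≡ k × T ⊆ᵇ U ≡ true × 𝒜 ∈ sublists (free (suc k) T U)
  ∈-withLowers⁻ {m} {k} {U} z∈ with T , T∈ , z∈′ ← ∈-concatMap⁻ (withFamilies k U) (subsetsOf U k) z∈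
    with 𝒜 , refl , 𝒜∈ ← ∈-withFamilies⁻ z∈′
    with _ , e ← ∈-filterᵇ⁻ _ (allSubsets m) T∈ =
    T , 𝒜 , refl , hasSize⁻ T (proj₁ (∧≡true⁻ e)) , proj₂ (∧≡true⁻ e) , 𝒜∈

∈-triples⁻ : ∀ {k} {z : Triple m} → z ∈ triples m k → IsTriple k z
∈-triples⁻ {m} {k} z∈ with U , U∈ , z∈′ ← ∈-concatMap⁻ (withLowers k) (levelSets m (2 + k)) z∈
  with T , 𝒜 , refl , ∣T∣ , T⊆U , 𝒜∈ ← ∈-withLowers⁻ z∈′ =
  ∣T∣ , hasSize⁻ U (proj₂ (∈-filterᵇ⁻ _ (allSubsets m) U∈)) , T⊆U , 𝒜∈

Unique-triples : ∀ m k → Unique (triples m k)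
Unique-triples m k =
  Unique-concatMap (withLowers k) (Unique.filter⁺ _ (Unique-allSubsets m)) (λ _ → Unique-withLowers)
    λ _ _ z∈ z∈′ → let _ , _ , e , _ = ∈-withLowers⁻ z∈ ; _ , _ , e′ , _ = ∈-withLowers⁻ z∈′ in
      proj₁ (,-injective (,-injectiveʳ (trans (sym e) e′)))
  where
  Unique-withLowers : ∀ {U} → Unique (withLowers k U)
  Unique-withLowers {U} =
    Unique-concatMap (withFamilies k U) (Unique.filter⁺ _ (Unique-allSubsets m))
      (λ {T} _ → Unique.map⁺ (,-injectiveʳ ∘ ,-injectiveʳ) (Unique-sublists (Unique-free (suc k) T U)))
      λ _ _ z∈ z∈′ → let _ , e , _ = ∈-withFamilies⁻ z∈ ; _ , e′ , _ = ∈-withFamilies⁻ z∈′ in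
        proj₁ (,-injective (trans (sym e) e′))

length-triples-≥ : ∀ m k →
  (m C (2 + k)) * (((2 + k) C k) * 2 ^ (m C suc k)) ≤ length (triples m k) * 2 ^ (m + 2)
length-triples-≥ m k =
  subst (λ n → n * (((2 + k) C k) * 2 ^ (m C suc k)) ≤ length (triples m k) * 2 ^ (m + 2)) (countᵇ-hasSize m (2 + k))
  (length-concatMap-≥ (withLowers k) (levelSets m (2 + k)) _ _ perUpper)
  where
  perFamily : ∀ {T U : Subset m} → ∣ T ∣ ≡ k → ∣ U ∣ ≡ 2 + k →
    2 ^ (m C suc k) ≤ length (withFamilies k U T) * 2 ^ (m + 2)
  perFamily {T} {U} ∣T∣ ∣U∣ = begin
    2 ^ (m C suc k)                                       ≤⟨ ^-monoʳ-≤ 2 (free-≥ T U ∣T∣ ∣U∣) ⟩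
    2 ^ (length (free (suc k) T U) + (m + 2))            ≡⟨ ^-distribˡ-+-* 2 (length (free (suc k) T U)) (m + 2) ⟩
    2 ^ length (free (suc k) T U) * 2 ^ (m + 2)          ≡⟨ cong (_* 2 ^ (m + 2)) families ⟨
    length (withFamilies k U T) * 2 ^ (m + 2)            ∎
    where
    open ≤-Reasoning
    families : length (withFamilies k U T) ≡ 2 ^ length (free (suc k) T U)
    families = trans (length-map _ (sublists (free (suc k) T U))) (length-sublists (free (suc k) T U))
  perUpper : ∀ {U} → U ∈ levelSets m (2 + k) →
    ((2 + k) C k) * 2 ^ (m C suc k) ≤ length (withLowers k U) * 2 ^ (m + 2)
  perUpper {U} U∈ = subst (λ n → n * 2 ^ (m C suc k) ≤ length (withLowers k U) * 2 ^ (m + 2)) lowers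
    (length-concatMap-≥ (withFamilies k U) (subsetsOf U k) _ _ λ {T} T∈ →
      perFamily (hasSize⁻ T (proj₁ (∧≡true⁻ (proj₂ (∈-filterᵇ⁻ _ (allSubsets m) T∈))))) ∣U∣)
    where
    ∣U∣ : ∣ U ∣ ≡ 2 + k
    ∣U∣ = hasSize⁻ U (proj₂ (∈-filterᵇ⁻ _ (allSubsets m) U∈))
    lowers : length (subsetsOf U k) ≡ (2 + k) C k
    lowers = trans (countᵇ-⊆ m U k) (cong (_C k) ∣U∣)

encode : ∀ k → Triple m → List (Subset (suc m))
encode k (T , U , 𝒜) = MIS.I (suc k) T U 𝒜

length-triples-≤-mis : ∀ m k → length (triples m k) ≤ mis (B (suc m) (suc k))
length-triples-≤-mis m k = begin
  length (triples m k)                    ≡⟨ length-map (encode k) (triples m k) ⟨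
  length (map (encode k) (triples m k))    ≤⟨ length-≤-⊆ (Unique-map⁺ injective (Unique-triples m k)) isMIS-encode ⟩
  mis (B (suc m) (suc k))                 ∎
  where
  open ≤-Reasoning
  injective : ∀ {x y} → x ∈ triples m k → y ∈ triples m k → encode k x ≡ encode k y → x ≡ y
  injective x∈ y∈ with ∣T∣ , ∣U∣ , T⊆U , 𝒜∈ ← ∈-triples⁻ x∈ | ∣T′∣ , ∣U′∣ , T′⊆U′ , 𝒜′∈ ← ∈-triples⁻ y∈ =
    MIS-injective (cong suc ∣T∣) ∣U∣ T⊆U (cong suc ∣T′∣) ∣U′∣ T′⊆U′ 𝒜∈ 𝒜′∈
  isMIS-encode : ∀ {I} → I ∈ map (encode k) (triples m k) →
    I ∈ filterᵇ (isMIS (B (suc m) (suc k))) (sublists (levelVerts (suc m) (suc k)))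
  isMIS-encode I∈ with (T , U , 𝒜) , z∈ , refl ← ∈-map⁻ (encode k) I∈ with ∣T∣ , ∣U∣ , T⊆U , _ ← ∈-triples⁻ z∈ =
    ∈-filterᵇ⁺ _ (filterᵇ∈sublists (MIS.chosen (suc k) T U 𝒜) (levelVerts (suc m) (suc k)))
      (MIS.Valid.I-isMIS (suc k) T U 𝒜 (cong suc ∣T∣) ∣U∣ T⊆U)

mis-≥ : ∀ m k →
  (m C (2 + k)) * (((2 + k) C k) * 2 ^ (m C suc k)) ≤ mis (B (suc m) (suc k)) * 2 ^ (m + 2)
mis-≥ m k = ≤-trans (length-triples-≥ m k) (*-monoˡ-≤ (2 ^ (m + 2)) (length-triples-≤-mis m k))

-- Binomial coefficients near the middle

[a+b]^L*c≤a^L*a : ∀ L a b c → c + L * b ≤ a → (a + b) ^ L * c ≤ a ^ L * a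
[a+b]^L*c≤a^L*a zero    a b c c≤a = subst₂ _≤_ (sym (*-identityˡ c)) (sym (*-identityˡ a)) (m+n≤o⇒m≤o c c≤a)
[a+b]^L*c≤a^L*a (suc L) a b c h = begin
  (a + b) * (a + b) ^ L * c    ≡⟨ e₁ (a + b) ((a + b) ^ L) c ⟩
  (a + b) ^ L * ((a + b) * c)  ≤⟨ *-monoʳ-≤ ((a + b) ^ L) step ⟩
  (a + b) ^ L * (a * (c + b))  ≡⟨ e₂ ((a + b) ^ L) a (c + b) ⟩
  a * ((a + b) ^ L * (c + b))  ≤⟨ *-monoʳ-≤ a ([a+b]^L*c≤a^L*a L a b (c + b) h′) ⟩
  a * (a ^ L * a)              ≡⟨ *-assoc a (a ^ L) a ⟨
  a * a ^ L * a                ∎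
  where
  open ≤-Reasoning
  e₁ : ∀ x y z → x * y * z ≡ y * (x * z)
  e₁ = solve-∀
  e₂ : ∀ x y z → x * (y * z) ≡ y * (x * z)
  e₂ = solve-∀
  h′ : c + b + L * b ≤ a
  h′ = subst (_≤ a) (sym (+-assoc c b (L * b))) h
  step : (a + b) * c ≤ a * (c + b)
  step = subst₂ _≤_ (sym (*-distribʳ-+ c a b)) (trans (cong (a * c +_) (*-comm b a)) (sym (*-distribˡ-+ a c b)))
    (+-monoʳ-≤ (a * c) (*-monoʳ-≤ b (m+n≤o⇒m≤o c h)))

[a+b]^L≤2*a^L : ∀ L a b → 1 ≤ a → 2 * (L * b) ≤ a → (a + b) ^ L ≤ 2 * a ^ L
[a+b]^L≤2*a^L L a b 1≤a 2Lb≤a = *-cancelʳ-≤ _ _ a {{>-nonZero 1≤a}} (begin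
  (a + b) ^ L * a        ≤⟨ *-monoʳ-≤ ((a + b) ^ L) a≤2c ⟩
  (a + b) ^ L * (2 * c)  ≡⟨ e ((a + b) ^ L) c ⟩
  2 * ((a + b) ^ L * c)  ≤⟨ *-monoʳ-≤ 2 ([a+b]^L*c≤a^L*a L a b c (≤-reflexive (m∸n+n≡m Lb≤a))) ⟩
  2 * (a ^ L * a)        ≡⟨ *-assoc 2 (a ^ L) a ⟨
  2 * a ^ L * a          ∎)
  where
  open ≤-Reasoning
  c = a ∸ L * b
  Lb+Lb≤a : L * b + L * b ≤ a
  Lb+Lb≤a = subst (_≤ a) (cong (L * b +_) (+-identityʳ (L * b))) 2Lb≤a
  Lb≤a : L * b ≤ a
  Lb≤a = ≤-trans (m≤n+m (L * b) (L * b)) Lb+Lb≤a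
  a≤2c : a ≤ 2 * c
  a≤2c = subst₂ _≤_ (m∸n+n≡m Lb≤a) (cong (c +_) (sym (+-identityʳ c)))
           (+-monoʳ-≤ c (m+n≤o⇒m≤o∸n (L * b) Lb+Lb≤a))
  e : ∀ y c → y * (2 * c) ≡ 2 * (y * c)
  e = solve-∀

-- Large constants are kept as right factors: _*_ recurses on its left
-- argument, so a literal on the left is unfolded that many times whenever
-- two such products have to be compared.
[a+b]^t≤a^t*2^Q : ∀ Q L t a b → 1 ≤ a → 2 * (L * b) ≤ a → t ≤ Q * L → (a + b) ^ t ≤ a ^ t * 2 ^ Q
[a+b]^t≤a^t*2^Q zero    L zero a b _ _ _ = ≤-refl
[a+b]^t≤a^t*2^Q (suc Q) L t a b 1≤a 2Lb≤a t≤QL with t ≤? L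
... | yes t≤L = ≤-trans ([a+b]^L≤2*a^L t a b 1≤a (≤-trans (*-monoʳ-≤ 2 (*-monoˡ-≤ b t≤L)) 2Lb≤a))
                  (≤-trans (≤-reflexive (*-comm 2 (a ^ t))) (*-monoʳ-≤ (a ^ t) (*-monoʳ-≤ 2 (m^n>0 2 Q))))
... | no  t≰L = subst (λ s → (a + b) ^ s ≤ a ^ s * 2 ^ suc Q) L+r≡t (begin
  (a + b) ^ (L + r)              ≡⟨ ^-distribˡ-+-* (a + b) L r ⟩
  (a + b) ^ L * (a + b) ^ r      ≤⟨ *-mono-≤ ([a+b]^L≤2*a^L L a b 1≤a 2Lb≤a) ([a+b]^t≤a^t*2^Q Q L r a b 1≤a 2Lb≤a r≤QL) ⟩
  (2 * a ^ L) * (a ^ r * 2 ^ Q)  ≡⟨ e (a ^ L) (a ^ r) (2 ^ Q) ⟩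
  (a ^ L * a ^ r) * (2 * 2 ^ Q)  ≡⟨ cong (_* (2 * 2 ^ Q)) (^-distribˡ-+-* a L r) ⟨
  a ^ (L + r) * (2 * 2 ^ Q)      ∎)
  where
  open ≤-Reasoning
  r = t ∸ L
  L+r≡t : L + r ≡ t
  L+r≡t = m+[n∸m]≡n (<⇒≤ (≰⇒> t≰L))
  r≤QL : r ≤ Q * L
  r≤QL = subst (r ≤_) (m+n∸n≡m (Q * L) L) (∸-monoˡ-≤ L (subst (t ≤_) (+-comm L (Q * L)) t≤QL))
  e : ∀ x y z → (2 * x) * (y * z) ≡ (x * y) * (2 * z)
  e = solve-∀

module _ (h s : ℕ) where
  private
    c : ℕ → ℕ
    c t = (h + h) C (h + t)

  C-step-≤ : ∀ t → suc t ≤ s → c t * (h ∸ s) ≤ c (suc t) * (h + s)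
  C-step-≤ t t<s = begin
    c t * (h ∸ s)                                ≤⟨ *-monoʳ-≤ (c t) (∸-monoʳ-≤ h (≤-trans (n≤1+n t) t<s)) ⟩
    c t * (h ∸ t)                                ≡⟨ cong (c t *_) ([m+n]∸[m+o]≡n∸o h h t) ⟨
    c t * ((h + h) ∸ (h + t))                    ≡⟨ *-distribˡ-∸ (c t) (h + h) (h + t) ⟩
    c t * (h + h) ∸ c t * (h + t)                ≡⟨ cong (_∸ c t * (h + t)) ratio ⟨
    c (suc t) * suc (h + t) + c t * (h + t) ∸ c t * (h + t)
                                                 ≡⟨ m+n∸n≡m (c (suc t) * suc (h + t)) (c t * (h + t)) ⟩
    c (suc t) * suc (h + t)                      ≤⟨ *-monoʳ-≤ (c (suc t)) (subst (_≤ h + s) (+-suc h t) (+-monoʳ-≤ h t<s)) ⟩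
    c (suc t) * (h + s)                          ∎
    where
    open ≤-Reasoning
    ratio : c (suc t) * suc (h + t) + c t * (h + t) ≡ c t * (h + h)
    ratio = subst (λ j → ((h + h) C j) * suc (h + t) + c t * (h + t) ≡ c t * (h + h)) (sym (+-suc h t))
              (C-ratio (h + h) (h + t))

  C-decay : ∀ t → t ≤ s → c 0 * (h ∸ s) ^ t ≤ c t * (h + s) ^ t
  C-decay zero    _   = ≤-refl
  C-decay (suc t) t<s = begin
    c 0 * ((h ∸ s) * (h ∸ s) ^ t)      ≡⟨ x∙yz≈y∙xz (c 0) (h ∸ s) ((h ∸ s) ^ t) ⟩
    (h ∸ s) * (c 0 * (h ∸ s) ^ t)      ≤⟨ *-monoʳ-≤ (h ∸ s) (C-decay t (≤-trans (n≤1+n t) t<s)) ⟩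
    (h ∸ s) * (c t * (h + s) ^ t)      ≡⟨ x∙yz≈yx∙z (h ∸ s) (c t) ((h + s) ^ t) ⟩
    (c t * (h ∸ s)) * (h + s) ^ t      ≤⟨ *-monoˡ-≤ ((h + s) ^ t) (C-step-≤ t t<s) ⟩
    (c (suc t) * (h + s)) * (h + s) ^ t ≡⟨ *-assoc (c (suc t)) (h + s) ((h + s) ^ t) ⟩
    c (suc t) * ((h + s) * (h + s) ^ t) ∎
    where open ≤-Reasoning

∃-multiple-near : ∀ d t → ∃[ L ] t ≤ suc d * L × suc d * L ≤ t + suc d
∃-multiple-near d zero = 0 , z≤n , subst (_≤ suc d) (sym (*-zeroʳ (suc d))) z≤n
∃-multiple-near d (suc t) with L , t≤ , ≤t+ ← ∃-multiple-near d t with suc t ≤? suc d * L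
... | yes t<  = L , t< , ≤-trans ≤t+ (n≤1+n _)
... | no  t≮ = suc L , up , down
  where
  dL≤t : suc d * L ≤ t
  dL≤t = ≤-pred (≰⇒> t≮)
  up : suc t ≤ suc d * suc L
  up = subst (suc t ≤_) (sym (*-suc (suc d) L)) (≤-trans (s≤s t≤) (+-monoˡ-≤ (suc d * L) (s≤s (z≤n {d}))))
  down : suc d * suc L ≤ suc t + suc d
  down = subst (_≤ suc t + suc d) (sym (*-suc (suc d) L))
           (≤-trans (+-monoʳ-≤ (suc d) dL≤t) (≤-trans (≤-reflexive (+-comm (suc d) t)) (n≤1+n (t + suc d))))

-- C(2h,h)·(h-t)^t ≤ C(2h,h+t)·(h+t)^t, and splitting the exponent t into
-- 32 blocks of length L with 4Lt < h - t, each block contributes a factor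
-- (1 + 2t/(h-t))^L ≤ 2.
central-C-≤ : ∀ h t → 4 * (t * t) + 160 * t + 32 ≤ 32 * h → (h + h) C h ≤ ((h + h) C (h + t)) * 2 ^ 32
central-C-≤ h t bound = *-cancelʳ-≤ _ _ (a ^ t) {{m^n≢0 a t {{>-nonZero 1≤a}}}} (begin
  ((h + h) C h) * a ^ t                 ≡⟨ cong (λ j → ((h + h) C j) * a ^ t) (+-identityʳ h) ⟨
  ((h + h) C (h + 0)) * a ^ t           ≤⟨ C-decay h t t ≤-refl ⟩
  ((h + h) C (h + t)) * (h + t) ^ t     ≤⟨ *-monoʳ-≤ ((h + h) C (h + t)) blocks ⟩
  ((h + h) C (h + t)) * (a ^ t * 2 ^ 32) ≡⟨ x∙yz≈xz∙y ((h + h) C (h + t)) (a ^ t) (2 ^ 32) ⟩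
  ((h + h) C (h + t)) * 2 ^ 32 * a ^ t  ∎)
  where
  open ≤-Reasoning
  L = proj₁ (∃-multiple-near 31 t)
  t≤32L = proj₁ (proj₂ (∃-multiple-near 31 t))
  32L≤t+32 = proj₂ (proj₂ (∃-multiple-near 31 t))
  4Lt+t+1≤h : 4 * (L * t) + t + 1 ≤ h
  4Lt+t+1≤h = *-cancelˡ-≤ 32 (begin
    32 * (4 * (L * t) + t + 1)          ≡⟨ e₁ L t ⟩
    4 * ((32 * L) * t) + 32 * t + 32    ≤⟨ +-monoˡ-≤ 32 (+-monoˡ-≤ (32 * t) (*-monoʳ-≤ 4 (*-monoˡ-≤ t 32L≤t+32))) ⟩
    4 * ((t + 32) * t) + 32 * t + 32    ≡⟨ e₂ t ⟩
    4 * (t * t) + 160 * t + 32          ≤⟨ bound ⟩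
    32 * h                              ∎)
    where
    e₁ : ∀ L t → 32 * (4 * (L * t) + t + 1) ≡ 4 * ((32 * L) * t) + 32 * t + 32
    e₁ = solve-∀
    e₂ : ∀ t → 4 * ((t + 32) * t) + 32 * t + 32 ≡ 4 * (t * t) + 160 * t + 32
    e₂ = solve-∀
  t≤h : t ≤ h
  t≤h = ≤-trans (m≤n+m t (4 * (L * t))) (≤-trans (m≤m+n _ 1) 4Lt+t+1≤h)
  a = h ∸ t
  4Lt+1≤a : 4 * (L * t) + 1 ≤ a
  4Lt+1≤a = m+n≤o⇒m≤o∸n (4 * (L * t) + 1) (subst (_≤ h) (e (4 * (L * t)) t) 4Lt+t+1≤h)
    where e : ∀ x t → x + t + 1 ≡ x + 1 + t
          e = solve-∀
  1≤a : 1 ≤ a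
  1≤a = ≤-trans (m≤n+m 1 _) 4Lt+1≤a
  blocks : (h + t) ^ t ≤ a ^ t * 2 ^ 32
  blocks = subst (λ x → x ^ t ≤ a ^ t * 2 ^ 32) (trans (e a t) (cong (_+ t) (m∸n+n≡m t≤h)))
    ([a+b]^t≤a^t*2^Q 32 L t a (2 * t) 1≤a (≤-trans (≤-reflexive (e′ L t)) (m+n≤o⇒m≤o _ 4Lt+1≤a)) t≤32L)
    where e : ∀ a t → a + 2 * t ≡ a + t + t
          e = solve-∀
          e′ : ∀ L t → 2 * (L * (2 * t)) ≡ 4 * (L * t)
          e′ = solve-∀

private
  central : ℕ → ℕ
  central h = (suc h + suc h) C suc h

  central-step : ∀ h → central (suc h) * suc (suc h) ≡ 2 * ((suc h + suc (suc h)) * central h)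
  central-step h = begin
    ((suc (suc h) + suc (suc h)) C suc (suc h)) * suc (suc h)
      ≡⟨ cong (λ n → (n C suc (suc h)) * suc (suc h)) 2+2h+2≡ ⟩
    (suc n C suc (suc h)) * suc (suc h)
      ≡⟨ cong (_* suc (suc h)) (pascal n (suc h)) ⟩
    (n C suc h + n C suc (suc h)) * suc (suc h)
      ≡⟨ cong (λ x → (x + n C suc (suc h)) * suc (suc h)) symmetric ⟩
    (n C suc (suc h) + n C suc (suc h)) * suc (suc h)
      ≡⟨ double (n C suc (suc h)) (suc (suc h)) ⟩
    2 * ((n C suc (suc h)) * suc (suc h))
      ≡⟨ cong (2 *_) (C-absorption (suc h + suc h) (suc h)) ⟩
    2 * (n * central h)
      ≡⟨ cong (λ x → 2 * (x * central h)) n≡ ⟨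
    2 * ((suc h + suc (suc h)) * central h)
      ∎
    where
    open ≡-Reasoning
    n = suc (suc h + suc h)
    n≡ : suc h + suc (suc h) ≡ n
    n≡ = +-suc (suc h) (suc h)
    2+2h+2≡ : suc (suc h) + suc (suc h) ≡ suc n
    2+2h+2≡ = cong suc n≡
    symmetric : n C suc h ≡ n C suc (suc h)
    symmetric = subst (λ x → x C suc h ≡ x C suc (suc h)) n≡ (C-symmetric (suc h) (suc (suc h)))
    double : ∀ y s → (y + y) * s ≡ 2 * (y * s)
    double = solve-∀

central-C-≥ : ∀ h → 16 ^ suc h ≤ 4 * suc h * (((suc h + suc h) C suc h) * ((suc h + suc h) C suc h))
central-C-≥ zero    = ≤-refl
central-C-≥ (suc h) = *-cancelˡ-≤ (suc (suc h)) (begin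
  suc (suc h) * (16 * 16 ^ suc h)                           ≤⟨ *-monoʳ-≤ (suc (suc h)) (*-monoʳ-≤ 16 (central-C-≥ h)) ⟩
  suc (suc h) * (16 * (4 * suc h * (c * c)))                ≡⟨ e₁ h c ⟩
  64 * (suc h * suc (suc h)) * (c * c)                      ≤⟨ *-monoˡ-≤ (c * c) am-gm ⟩
  16 * (s * s) * (c * c)                                    ≡⟨ e₂ s c ⟩
  4 * ((2 * (s * c)) * (2 * (s * c)))                       ≡⟨ cong (λ x → 4 * (x * x)) (central-step h) ⟨
  4 * ((c′ * suc (suc h)) * (c′ * suc (suc h)))             ≡⟨ e₃ c′ (suc (suc h)) ⟩
  suc (suc h) * (4 * suc (suc h) * (c′ * c′))               ∎)
  where
  open ≤-Reasoning
  c = central h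
  c′ = central (suc h)
  s = suc h + suc (suc h)
  am-gm : 64 * (suc h * suc (suc h)) ≤ 16 * (s * s)
  am-gm = subst (64 * (suc h * suc (suc h)) ≤_) (e h) (m≤m+n (64 * (suc h * suc (suc h))) 16)
    where e : ∀ h → 64 * (suc h * suc (suc h)) + 16 ≡ 16 * ((suc h + suc (suc h)) * (suc h + suc (suc h)))
          e = solve-∀
  e₁ : ∀ h c → suc (suc h) * (16 * (4 * suc h * (c * c))) ≡ 64 * (suc h * suc (suc h)) * (c * c)
  e₁ = solve-∀
  e₂ : ∀ s c → 16 * (s * s) * (c * c) ≡ 4 * ((2 * (s * c)) * (2 * (s * c)))
  e₂ = solve-∀
  e₃ : ∀ x s → 4 * ((x * s) * (x * s)) ≡ s * (4 * s * (x * x))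
  e₃ = solve-∀

[1+k]²≤2*[2+k]Ck : ∀ k → suc k * suc k ≤ 2 * ((2 + k) C k)
[1+k]²≤2*[2+k]Ck k = subst (suc k * suc k ≤_) (sym twice) (*-monoˡ-≤ (suc k) (n≤1+n (suc k)))
  where
  twice : 2 * ((2 + k) C k) ≡ (2 + k) * suc k
  twice = begin
    2 * ((2 + k) C k)        ≡⟨ cong (λ n → 2 * (n C k)) (+-comm 2 k) ⟩
    2 * ((k + 2) C k)        ≡⟨ cong (2 *_) (C-symmetric k 2) ⟩
    2 * ((k + 2) C 2)        ≡⟨ cong (λ n → 2 * (n C 2)) (+-comm k 2) ⟩
    2 * ((2 + k) C 2)        ≡⟨ *-comm 2 ((2 + k) C 2) ⟩
    ((2 + k) C 2) * 2        ≡⟨ C-absorption (suc k) 1 ⟩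
    (2 + k) * (suc k C 1)    ≡⟨ cong ((2 + k) *_) (nC1≡n (suc k)) ⟩
    (2 + k) * suc k          ∎
    where open ≡-Reasoning

private
  ≤∣-∣+n : ∀ {a b c} n → a + b ≤ c + n → a ≤ ∣ c - b ∣ + n
  ≤∣-∣+n {a} {b} {c} n a+b≤c+n = +-cancelʳ-≤ b a (∣ c - b ∣ + n) (begin
    a + b                 ≤⟨ a+b≤c+n ⟩
    c + n                 ≤⟨ +-monoˡ-≤ n (m≤∣m-n∣+n c b) ⟩
    ∣ c - b ∣ + b + n      ≡⟨ +-assoc ∣ c - b ∣ b n ⟩
    ∣ c - b ∣ + (b + n)    ≡⟨ cong (∣ c - b ∣ +_) (+-comm b n) ⟩
    ∣ c - b ∣ + (n + b)    ≡⟨ +-assoc ∣ c - b ∣ n b ⟨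
    ∣ c - b ∣ + n + b      ∎)
    where open ≤-Reasoning

even-or-odd : ∀ m → ∃[ h ] (m ≡ h + h ⊎ m ≡ suc (h + h))
even-or-odd zero = 0 , inj₁ refl
even-or-odd (suc m) with even-or-odd m
... | h , inj₁ refl = h , inj₂ refl
... | h , inj₂ refl = suc h , inj₁ (cong suc (sym (+-suc h h)))

C-mirror : ∀ {h j} → j ≤ h → (h + h) C (h + (h ∸ j)) ≡ (h + h) C j
C-mirror {h} {j} j≤h = subst (λ n → n C (h + (h ∸ j)) ≡ n C j) j+[h+t]≡h+h (sym (C-symmetric j (h + (h ∸ j))))
  where
  j+[h+t]≡h+h : j + (h + (h ∸ j)) ≡ h + h
  j+[h+t]≡h+h = trans (sym (+-assoc j h (h ∸ j))) (trans (cong (_+ (h ∸ j)) (+-comm j h))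
                  (trans (+-assoc h j (h ∸ j)) (cong (h +_) (m+[n∸m]≡n j≤h))))

C-≤-suc : ∀ n j → n C j ≤ suc n C j
C-≤-suc n zero    = ≤-refl
C-≤-suc n (suc j) = subst (n C suc j ≤_) (sym (pascal n j)) (m≤n+m (n C suc j) (n C j))

C-≤-suc-suc : ∀ n j → n C j ≤ suc n C suc j
C-≤-suc-suc n j = subst (n C j ≤_) (sym (pascal n j)) (m≤m+n (n C j) (n C suc j))

private
  middle-comparison′ : ∀ m k → ∃[ h ] ∃[ t ] (h + h ≤ m × m ≤ suc (h + h)) × (h + h) C (h + t) ≤ m C suc k ×
    (2 * t + suc m ≤ 2 * k + 3 ⊎ 2 * t + 2 * k ≤ suc m)
  middle-comparison′ m k with even-or-odd m
  ... | h , inj₁ refl with h ≤? suc k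
  ...   | yes h≤j = h , t , (≤-refl , n≤1+n _) , ≤-reflexive (cong ((h + h) C_) h+t≡j) ,
    inj₁ (≤-reflexive (trans (e h t) (trans (cong (λ x → 2 * x + 1) h+t≡j) (e′ k))))
    where
    t = suc k ∸ h
    h+t≡j = m+[n∸m]≡n h≤j
    e : ∀ h t → 2 * t + suc (h + h) ≡ 2 * (h + t) + 1
    e = solve-∀
    e′ : ∀ k → 2 * suc k + 1 ≡ 2 * k + 3
    e′ = solve-∀
  ...   | no  h≰j = h , t , (≤-refl , n≤1+n _) , ≤-reflexive (C-mirror j≤h) ,
    inj₂ (subst (λ x → 2 * t + 2 * k ≤ suc (x + x)) j+t≡h (≤-trans (m≤m+n _ 3) (≤-reflexive (e k t))))
    where
    j≤h = <⇒≤ (≰⇒> h≰j)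
    t = h ∸ suc k
    j+t≡h = m+[n∸m]≡n j≤h
    e : ∀ k t → 2 * t + 2 * k + 3 ≡ suc ((suc k + t) + (suc k + t))
    e = solve-∀
  middle-comparison′ m k | h , inj₂ refl with h ≤? k
  ...   | yes h≤k = h , t , (n≤1+n _ , ≤-refl) , ≤-trans (≤-reflexive (cong ((h + h) C_) h+t≡k)) (C-≤-suc-suc (h + h) k) ,
    inj₁ (subst (λ x → 2 * t + suc (suc (h + h)) ≤ 2 * x + 3) h+t≡k (≤-trans (m≤m+n _ 1) (≤-reflexive (e h t))))
    where
    t = k ∸ h
    h+t≡k = m+[n∸m]≡n h≤k
    e : ∀ h t → 2 * t + suc (suc (h + h)) + 1 ≡ 2 * (h + t) + 3
    e = solve-∀
  ...   | no  h≰k = h , t , (n≤1+n _ , ≤-refl) , ≤-trans (≤-reflexive (C-mirror j≤h)) (C-≤-suc (h + h) (suc k)) ,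
    inj₂ (subst (λ x → 2 * t + 2 * k ≤ suc (suc (x + x))) j+t≡h (≤-trans (m≤m+n _ 4) (≤-reflexive (e k t))))
    where
    j≤h = ≰⇒> h≰k
    t = h ∸ suc k
    j+t≡h = m+[n∸m]≡n j≤h
    e : ∀ k t → 2 * t + 2 * k + 4 ≡ suc (suc ((suc k + t) + (suc k + t)))
    e = solve-∀

middle-comparison : ∀ m k → ∃[ h ] ∃[ t ] (h + h ≤ m × m ≤ suc (h + h)) × (h + h) C (h + t) ≤ m C suc k ×
  2 * t ≤ ∣ 2 * k - suc m ∣ + 3
middle-comparison m k with h , t , h≈m , C≤ , bound ← middle-comparison′ m k = h , t , h≈m , C≤ , ≤∣2k-n∣+3 bound
  where
  ≤∣2k-n∣+3 : ∀ {a} → a + suc m ≤ 2 * k + 3 ⊎ a + 2 * k ≤ suc m → a ≤ ∣ 2 * k - suc m ∣ + 3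
  ≤∣2k-n∣+3 (inj₁ below) = ≤∣-∣+n 3 below
  ≤∣2k-n∣+3 (inj₂ above) = subst (λ x → _ ≤ x + 3) (∣-∣-comm (suc m) (2 * k)) (≤∣-∣+n {c = suc m} 3 (m≤n⇒m≤n+o 3 above))

private
  86d+289≤24h : ∀ h d → d * d ≤ 8 * h + 8 → 156 ≤ h → 86 * d + 289 ≤ 24 * h
  86d+289≤24h h d d²≤ 156≤h with d ≤? 31
  ... | yes d≤31 = ≤-trans (+-monoˡ-≤ 289 (*-monoʳ-≤ 86 d≤31)) (≤-trans (≤ᵇ⇒≤ 2955 3744 _) (*-monoʳ-≤ 24 156≤h))
  ... | no  d≰31 = begin
    86 * d + 289          ≤⟨ +-monoˡ-≤ 289 (*-monoˡ-≤ d (≤ᵇ⇒≤ 86 88 _)) ⟩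
    88 * d + 289          ≤⟨ +-monoˡ-≤ 289 88d≤ ⟩
    22 * h + 22 + 289     ≤⟨ subst₂ _≤_ (e₃ h) (e₄ h) (+-monoʳ-≤ (22 * h) (≤-trans (≤ᵇ⇒≤ 311 312 _) (*-monoʳ-≤ 2 156≤h))) ⟩
    24 * h                ∎
    where
    open ≤-Reasoning
    e₁ : ∀ d → 11 * (32 * d) ≡ 4 * (88 * d)
    e₁ = solve-∀
    e₂ : ∀ h → 11 * (8 * h + 8) ≡ 4 * (22 * h + 22)
    e₂ = solve-∀
    e₃ : ∀ h → 22 * h + 311 ≡ 22 * h + 22 + 289
    e₃ = solve-∀
    e₄ : ∀ h → 22 * h + 2 * h ≡ 24 * h
    e₄ = solve-∀
    88d≤ : 88 * d ≤ 22 * h + 22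
    88d≤ = *-cancelˡ-≤ 4 (subst₂ _≤_ (e₁ d) (e₂ h) (*-monoʳ-≤ 11 (≤-trans (*-monoˡ-≤ d (≰⇒> d≰31)) d²≤)))

shift-fits : ∀ h t d → 2 * t ≤ d + 3 → d * d ≤ 8 * h + 8 → 156 ≤ h → 4 * (t * t) + 160 * t + 32 ≤ 32 * h
shift-fits h t d 2t≤ d²≤ 156≤h = begin
  4 * (t * t) + 160 * t + 32                  ≡⟨ e₁ t ⟩
  (2 * t) * (2 * t) + 80 * (2 * t) + 32       ≤⟨ +-monoˡ-≤ 32 (+-mono-≤ (*-mono-≤ 2t≤ 2t≤) (*-monoʳ-≤ 80 2t≤)) ⟩
  (d + 3) * (d + 3) + 80 * (d + 3) + 32       ≡⟨ e₂ d ⟩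
  d * d + (86 * d + 281)                      ≤⟨ +-monoˡ-≤ (86 * d + 281) d²≤ ⟩
  8 * h + 8 + (86 * d + 281)                  ≡⟨ e₃ h d ⟩
  8 * h + (86 * d + 289)                      ≤⟨ +-monoʳ-≤ (8 * h) (86d+289≤24h h d d²≤ 156≤h) ⟩
  8 * h + 24 * h                              ≡⟨ e₄ h ⟩
  32 * h                                      ∎
  where
  open ≤-Reasoning
  e₁ : ∀ t → 4 * (t * t) + 160 * t + 32 ≡ (2 * t) * (2 * t) + 80 * (2 * t) + 32
  e₁ = solve-∀
  e₂ : ∀ d → (d + 3) * (d + 3) + 80 * (d + 3) + 32 ≡ d * d + (86 * d + 281)
  e₂ = solve-∀
  e₃ : ∀ h d → 8 * h + 8 + (86 * d + 281) ≡ 8 * h + (86 * d + 289)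
  e₃ = solve-∀
  e₄ : ∀ h → 8 * h + 24 * h ≡ 32 * h
  e₄ = solve-∀

n≤4k : ∀ n k → ∣ 2 * k - n ∣ * ∣ 2 * k - n ∣ ≤ 4 * n → 16 ≤ n → n ≤ 4 * k
n≤4k n k d²≤4n 16≤n with n ≤? 4 * k
... | yes n≤4k = n≤4k
... | no  n≰4k = ⊥-elim (1+n≰n (≤-trans n²<16n 16n≤n²))
  where
  d = ∣ 2 * k - n ∣
  n≤d+2k : n ≤ d + 2 * k
  n≤d+2k = subst (λ x → n ≤ x + 2 * k) (∣-∣-comm n (2 * k)) (m≤∣m-n∣+n n (2 * k))
  n<2d : n < 2 * d
  n<2d = +-cancelʳ-< n n (2 * d) (subst (_< 2 * d + n) (e₂ n) (begin-strict
    2 * n               ≤⟨ subst (2 * n ≤_) (e₁ d k) (*-monoʳ-≤ 2 n≤d+2k) ⟩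
    2 * d + 4 * k       <⟨ +-monoʳ-< (2 * d) (≰⇒> n≰4k) ⟩
    2 * d + n           ∎))
    where
    open ≤-Reasoning
    e₁ : ∀ d k → 2 * (d + 2 * k) ≡ 2 * d + 4 * k
    e₁ = solve-∀
    e₂ : ∀ n → 2 * n ≡ n + n
    e₂ = solve-∀
  n²<16n : suc (n * n) ≤ 16 * n
  n²<16n = ≤-trans (*-mono-< n<2d n<2d) (subst₂ _≤_ (sym (e₁ d)) (e₂ n) (*-monoʳ-≤ 4 d²≤4n))
    where
    e₁ : ∀ d → (2 * d) * (2 * d) ≡ 4 * (d * d)
    e₁ = solve-∀
    e₂ : ∀ n → 4 * (4 * n) ≡ 16 * n
    e₂ = solve-∀
  16n≤n² : 16 * n ≤ n * n
  16n≤n² = *-monoˡ-≤ n 16≤n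

C-near-middle-≥ : ∀ m k → 400 ≤ suc m → ∣ 2 * k - suc m ∣ * ∣ 2 * k - suc m ∣ ≤ 4 * suc m →
  2 ^ (m + 2) * 2 ^ (m + 2) ≤ suc m * ((m C suc k) * (m C suc k)) * 2 ^ 71
C-near-middle-≥ m k 400≤n d²≤4n with middle-comparison m k
... | zero , _ , (_ , m≤1) , _ = ⊥-elim (1+n≰n (≤-trans 400≤n (≤-trans (s≤s m≤1) (≤ᵇ⇒≤ 2 399 _))))
... | suc h′ , t , (2h≤m , m≤2h+1) , c′≤ , 2t≤ = begin
  2 ^ (m + 2) * 2 ^ (m + 2)              ≡⟨ ^-distribˡ-+-* 2 (m + 2) (m + 2) ⟨
  2 ^ (m + 2 + (m + 2))                  ≤⟨ ^-monoʳ-≤ 2 (≤-trans (+-mono-≤ m+2≤ m+2≤) (≤-reflexive (e₁ h))) ⟩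
  2 ^ (6 + 4 * h)                        ≡⟨ trans (^-distribˡ-+-* 2 6 (4 * h)) (cong (64 *_) (sym (^-*-assoc 2 4 h))) ⟩
  64 * 16 ^ h                            ≤⟨ *-monoʳ-≤ 64 (central-C-≥ h′) ⟩
  64 * (4 * h * (c * c))                 ≤⟨ *-monoʳ-≤ 64 (*-mono-≤ 4h≤2n (*-mono-≤ c≤ c≤)) ⟩
  64 * (2 * suc m * ((b * 2 ^ 32) * (b * 2 ^ 32)))  ≡⟨ e₂ (suc m) (2 ^ 32) b ⟩
  suc m * (b * b) * (128 * (2 ^ 32 * 2 ^ 32))       ≡⟨ cong (suc m * (b * b) *_) 2⁷*2³²*2³²≡2⁷¹ ⟩
  suc m * (b * b) * 2 ^ 71               ∎
  where
  open ≤-Reasoning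
  h = suc h′
  b = m C suc k
  c = (h + h) C h
  2⁷*2³²*2³²≡2⁷¹ : 128 * (2 ^ 32 * 2 ^ 32) ≡ 2 ^ 71
  2⁷*2³²*2³²≡2⁷¹ = refl
  m+2≤ : m + 2 ≤ suc (h + h) + 2
  m+2≤ = +-monoˡ-≤ 2 m≤2h+1
  e₁ : ∀ h → suc (h + h) + 2 + (suc (h + h) + 2) ≡ 6 + 4 * h
  e₁ = solve-∀
  e₂ : ∀ n K b → 64 * (2 * n * ((b * K) * (b * K))) ≡ n * (b * b) * (128 * (K * K))
  e₂ = solve-∀
  4h≤2n : 4 * h ≤ 2 * suc m
  4h≤2n = ≤-trans (≤-reflexive (e h)) (*-monoʳ-≤ 2 (≤-trans 2h≤m (n≤1+n m)))
    where e : ∀ h → 4 * h ≡ 2 * (h + h)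
          e = solve-∀
  156≤h : 156 ≤ h
  156≤h = *-cancelˡ-≤ 2 (≤-trans (≤ᵇ⇒≤ 312 398 _) (≤-trans (≤-pred (≤-trans (≤-pred 400≤n) m≤2h+1)) (≤-reflexive (e h))))
    where e : ∀ h → h + h ≡ 2 * h
          e = solve-∀
  d²≤8h+8 : ∣ 2 * k - suc m ∣ * ∣ 2 * k - suc m ∣ ≤ 8 * h + 8
  d²≤8h+8 = ≤-trans d²≤4n (≤-trans (*-monoʳ-≤ 4 (s≤s m≤2h+1)) (≤-reflexive (e h)))
    where e : ∀ h → 4 * suc (suc (h + h)) ≡ 8 * h + 8
          e = solve-∀
  c≤ : c ≤ b * 2 ^ 32
  c≤ = ≤-trans (central-C-≤ h t (shift-fits h t _ 2t≤ d²≤8h+8 156≤h)) (*-monoˡ-≤ (2 ^ 32) c′≤)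

C-products-≥ : ∀ m k → 400 ≤ suc m → ∣ 2 * suc k - suc m ∣ * ∣ 2 * suc k - suc m ∣ ≤ 4 * suc m →
  suc m ^ 3 * (2 ^ (m + 2) * 2 ^ (m + 2)) ≤ ((m C (2 + k)) * ((2 + k) C k)) * ((m C (2 + k)) * ((2 + k) C k)) * 2 ^ 81
C-products-≥ m k 400≤n d²≤4n = begin
  n ^ 3 * (W * W)                   ≤⟨ *-monoʳ-≤ (n ^ 3) (C-near-middle-≥ m (suc k) 400≤n d²≤4n) ⟩
  n ^ 3 * (n * (b * b) * 2 ^ 71)    ≡⟨ e₁ n b (2 ^ 71) ⟩
  ((n * n) * (n * n)) * (b * b) * 2 ^ 71   ≤⟨ *-monoˡ-≤ (2 ^ 71) (*-monoˡ-≤ (b * b) (*-mono-≤ n²≤ n²≤)) ⟩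
  ((32 * y) * (32 * y)) * (b * b) * 2 ^ 71 ≡⟨ e₂ b y (2 ^ 71) ⟩
  (b * y) * (b * y) * (2 ^ 71 * 1024)   ≡⟨ cong ((b * y) * (b * y) *_) 2⁷¹*2¹⁰≡2⁸¹ ⟩
  (b * y) * (b * y) * 2 ^ 81            ∎
  where
  open ≤-Reasoning
  n = suc m
  W = 2 ^ (m + 2)
  b = m C (2 + k)
  y = (2 + k) C k
  2⁷¹*2¹⁰≡2⁸¹ : 2 ^ 71 * 1024 ≡ 2 ^ 81
  2⁷¹*2¹⁰≡2⁸¹ = refl
  n≤4[1+k] : n ≤ 4 * suc k
  n≤4[1+k] = n≤4k n (suc k) d²≤4n (≤-trans (≤ᵇ⇒≤ 16 400 _) 400≤n)
  n²≤ : n * n ≤ 32 * y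
  n²≤ = ≤-trans (*-mono-≤ n≤4[1+k] n≤4[1+k]) (subst₂ _≤_ (e₃ (suc k)) (sym (*-assoc 16 2 y)) (*-monoʳ-≤ 16 ([1+k]²≤2*[2+k]Ck k)))
    where e₃ : ∀ x → 16 * (x * x) ≡ 4 * x * (4 * x)
          e₃ = solve-∀
  e₁ : ∀ n b c → n * (n * (n * 1)) * (n * (b * b) * c) ≡ ((n * n) * (n * n)) * (b * b) * c
  e₁ = solve-∀
  e₂ : ∀ b y c → ((32 * y) * (32 * y)) * (b * b) * c ≡ (b * y) * (b * y) * (c * 1024)
  e₂ = solve-∀

mis-≥-near-middle : ∀ m k → 400 ≤ suc m → ∣ 2 * suc k - suc m ∣ * ∣ 2 * suc k - suc m ∣ ≤ 4 * suc m →
  suc m ^ 3 * (2 ^ (m C suc k) * 2 ^ (m C suc k))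
    ≤ (2 ^ 41 * mis (B (suc m) (suc k))) * (2 ^ 41 * mis (B (suc m) (suc k)))
mis-≥-near-middle m k 400≤n d²≤4n =
  *-cancelʳ-≤ _ _ (W * W) {{m*n≢0 W W {{m^n≢0 2 (m + 2)}} {{m^n≢0 2 (m + 2)}}}} (begin
    n ^ 3 * (Z * Z) * (W * W)              ≡⟨ e₁ (n ^ 3) Z W ⟩
    n ^ 3 * (W * W) * (Z * Z)              ≤⟨ *-monoˡ-≤ (Z * Z) (C-products-≥ m k 400≤n d²≤4n) ⟩
    (b * y) * (b * y) * 2 ^ 81 * (Z * Z)    ≡⟨ e₂ b y Z (2 ^ 81) ⟩
    (b * (y * Z)) * (b * (y * Z)) * 2 ^ 81  ≤⟨ *-monoˡ-≤ (2 ^ 81) (*-mono-≤ (mis-≥ m k) (mis-≥ m k)) ⟩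
    (M * W) * (M * W) * 2 ^ 81             ≤⟨ *-monoʳ-≤ ((M * W) * (M * W)) (≤ᵇ⇒≤ (2 ^ 81) (2 ^ 41 * 2 ^ 41) _) ⟩
    (M * W) * (M * W) * (2 ^ 41 * 2 ^ 41)  ≡⟨ e₃ (2 ^ 41) M W ⟩
    (2 ^ 41 * M) * (2 ^ 41 * M) * (W * W)  ∎)
  where
  open ≤-Reasoning
  n = suc m
  M = mis (B (suc m) (suc k))
  b = m C (2 + k)
  y = (2 + k) C k
  Z = 2 ^ (m C suc k)
  W = 2 ^ (m + 2)
  e₁ : ∀ c z w → c * (z * z) * (w * w) ≡ c * (w * w) * (z * z)
  e₁ = solve-∀
  e₂ : ∀ b y z c → (b * y) * (b * y) * c * (z * z) ≡ (b * (y * z)) * (b * (y * z)) * c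
  e₂ = solve-∀
  e₃ : ∀ q x w → (x * w) * (x * w) * (q * q) ≡ (q * x) * (q * x) * (w * w)
  e₃ = solve-∀

proposition8p2 : Σ ℕ λ p → Σ ℕ λ q → (0 < p) × (0 < q) × Σ ℕ λ N →
    (n k : ℕ) → N ≤ n → ∣ 2 * k - n ∣ * ∣ 2 * k - n ∣ ≤ 4 * n →
    p * p * n ^ 3 * (2 ^ ((n ∸ 1) C k) * 2 ^ ((n ∸ 1) C k))
      ≤ (q * mis (B n k)) * (q * mis (B n k))
proposition8p2 = 1 , 2 ^ 41 , s≤s z≤n , m^n>0 2 41 , 400 , bound
  where
  bound : ∀ n k → 400 ≤ n → ∣ 2 * k - n ∣ * ∣ 2 * k - n ∣ ≤ 4 * n →
    1 * 1 * n ^ 3 * (2 ^ ((n ∸ 1) C k) * 2 ^ ((n ∸ 1) C k)) ≤ (2 ^ 41 * mis (B n k)) * (2 ^ 41 * mis (B n k))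
  bound zero    _       ()
  bound (suc m) zero    400≤n d²≤4n = ⊥-elim (n≮0 (n≤4k (suc m) 0 d²≤4n (≤-trans (≤ᵇ⇒≤ 16 400 _) 400≤n)))
  bound (suc m) (suc k) 400≤n d²≤4n =
    ≤-trans (≤-reflexive (cong (_* (2 ^ (m C suc k) * 2 ^ (m C suc k))) (*-identityˡ (suc m ^ 3))))
            (mis-≥-near-middle m k 400≤n d²≤4n)
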